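{- For every composition $\alpha$, $$\mathcal{R}_\alpha=\sum_\beta d_{\alpha\beta}F_\beta,$$ where the sum is over compositions $\beta$ and $d_{\alpha\beta}$ is the number of standard Young row-strict composition tableaux $T$ of shape $\alpha$ with $\operatorname{comp}(\hat D(T))=\beta$.
   Context: Diagrams use the French convention: a composition $\alpha=(\alpha_1,\dots,\alpha_\ell)$ (finite sequence of positive integers, $|\alpha|=\sum\alpha_i$) has diagram with $\alpha_i$ left-justified cells in row $i$ from the bottom; cell $(i,j)$ is row $i$ from the bottom, column $j$ from the left. An SSYRT of shape $\alpha$ is a filling $T$ of its diagram with positive integers such that, with $T(i,j)=\infty$ for cells outside the diagram: (1) rows strictly increase left to right; (2) the leftmost column weakly decreases from top to bottom; (3) for $1\le i<j\le\ell(\alpha)$ and $1\le k<m$ ($m$ the largest part), if $T(j,k)<T(i,k+1)$ then $T(j,k+1)\le T(i,k+1)$. Its weight is $x^T=\prod_t x_t^{v_t}$, $v_t$ = number of entries equal to $t$; $\mathcal{R}_\alpha=\sum x^T$ over all SSYRT $T$ of shape $\alpha$. A standard one (SYRT) is an SSYRT containing each of $1,\dots,|\alpha|$ exactly once. For an SYRT $T$ with $n=|\alpha|$, the reverse descent set $\hat D(T)\subseteq[n-1]$ is the set of $i$ such that $i+1$ appears in a column strictly to the right of the column containing $i$. For $S=\{s_1<\dots<s_k\}\subseteq[n-1]$, $\operatorname{comp}(S)=(s_1,s_2-s_1,\dots,s_k-s_{k-1},n-s_k)$. The monomial quasisymmetric function is $M_\gamma=\sum_{i_1<\dots<i_k}x_{i_1}^{\gamma_1}\cdots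 x_{i_k}^{\gamma_k}$ and Gessel's fundamental quasisymmetric function is $F_\beta=\sum_{\gamma}M_\gamma$, summed over all compositions $\gamma$ refining $\beta$ (i.e. $\beta$ is obtained by summing consecutive parts of $\gamma$). -}

module Defs where

-- A monomial x_1^{v_1} ... x_N^{v_N} is encoded by its exponent list
-- v = (v_1,...,v_N) (trailing zeros allowed).  A formal power series is
-- determined by its coefficients on all such monomials.
-- Compositions, fillings, etc. are lists of naturals; rows of a filling
-- are listed from the bottom (row 1 = first list) as in French notation.

open import Data.Bool using (Bool; true; false; _∧_; _∨_; not)
open import Data.Nat using (ℕ; zero; suc; _+_; _*_; _∸_; _<ᵇ_; _≤ᵇ_; _≡ᵇ_; _⊔_)
open import Data.Maybe using (Maybe; just; nothing)
open import Data.List using (List; []; _∷_; [_]; map; concat; concatMap; upTo;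
  length; replicate; zip; take; drop; _++_; foldr)
open import Data.Nat.ListAction using (sum)
open import Data.Bool.ListAction using (all; any)
open import Data.Product using (_×_; _,_; proj₁; proj₂)

range1 : ℕ → List ℕ
range1 n = map suc (upTo n)

count : {A : Set} → (A → Bool) → List A → ℕ
count p []       = 0
count p (x ∷ xs) with p x
... | true  = suc (count p xs)
... | false = count p xs

filterᵇ : {A : Set} → (A → Bool) → List A → List A
filterᵇ p []       = []
filterᵇ p (x ∷ xs) with p x
... | true  = x ∷ filterᵇ p xs
... | false = filterᵇ p xs

_==ᴸ_ : List ℕ → List ℕ → Bool
[]       ==ᴸ []       = true
(x ∷ xs) ==ᴸ (y ∷ ys) = (x ≡ᵇ y) ∧ (xs ==ᴸ ys)
_        ==ᴸ _        = false

nth : {A : Set} → List A → ℕ → Maybe A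
nth []       _       = nothing
nth (x ∷ xs) zero    = just x
nth (x ∷ xs) (suc i) = nth xs i

maxPart : List ℕ → ℕ
maxPart = foldr _⊔_ 0

-- ℕ ∪ {∞} as Maybe ℕ (nothing = ∞) with the comparisons used

_<∞_ : Maybe ℕ → Maybe ℕ → Bool
just a  <∞ just b  = a <ᵇ b
just a  <∞ nothing = true
nothing <∞ _       = false

_≤∞_ : Maybe ℕ → Maybe ℕ → Bool
just a  ≤∞ just b  = a ≤ᵇ b
_       ≤∞ nothing = true
nothing ≤∞ just _  = false

vecs : ℕ → ℕ → List (List ℕ)
vecs N zero    = [ [] ]
vecs N (suc ℓ) = concatMap (λ x → map (x ∷_) (vecs N ℓ)) (range1 N)

-- all compositions of n (sequences of positive integers summing to n;
-- such a sequence has length ≤ n and parts ≤ n)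
comps : ℕ → List (List ℕ)
comps n = filterᵇ (λ γ → sum γ ≡ᵇ n) (concatMap (vecs n) (0 ∷ range1 n))

-- refines γ β : β is obtained from γ by summing consecutive parts of γ
refines : List ℕ → List ℕ → Bool
refines []      []      = true
refines (_ ∷ _) []      = false
refines γ       (b ∷ β) =
  any (λ i → (sum (take i γ) ≡ᵇ b) ∧ refines (drop i γ) β) (range1 (length γ))

Filling : Set
Filling = List (List ℕ)

fillings : ℕ → List ℕ → List Filling
fillings N []      = [ [] ]
fillings N (a ∷ α) = concatMap (λ r → map (r ∷_) (fillings N α)) (vecs N a)

-- T(i,j), 1-based (row i from the bottom, column j from the left);
-- nothing (= ∞) outside the diagram
cell : Filling → ℕ → ℕ → Maybe ℕ
cell T zero    _       = nothing
cell T (suc i) zero    = nothing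
cell T (suc i) (suc j) with nth T i
... | nothing  = nothing
... | just row = nth row j

strictlyInc : List ℕ → Bool
strictlyInc (x ∷ y ∷ r) = (x <ᵇ y) ∧ strictlyInc (y ∷ r)
strictlyInc _           = true

cond1 : Filling → Bool
cond1 T = all strictlyInc T

cond2 : List ℕ → Filling → Bool
cond2 α T = all (λ i → cell T i 1 ≤∞ cell T (suc i) 1) (range1 (length α ∸ 1))

cond3 : List ℕ → Filling → Bool
cond3 α T =
  all (λ i → all (λ j → not (i <ᵇ j) ∨
        all (λ k → not (cell T j k <∞ cell T i (suc k))
                   ∨ (cell T j (suc k) ≤∞ cell T i (suc k)))
            (range1 (maxPart α ∸ 1)))
      (range1 (length α)))
  (range1 (length α))

-- conditions (1)-(3); the shape and positivity of entries are
-- guaranteed by enumerating via 'fillings'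
isSSYRT : List ℕ → Filling → Bool
isSSYRT α T = cond1 T ∧ cond2 α T ∧ cond3 α T

content : ℕ → Filling → List ℕ
content N T = map (λ t → count (λ x → x ≡ᵇ t) (concat T)) (range1 N)

-- coefficient of x_1^{v_1}...x_N^{v_N} in R_α: number of SSYRT of shape α
-- of weight x^v (their entries necessarily lie in [1..N])
coeffR : List ℕ → List ℕ → ℕ
coeffR α v = count (λ T → isSSYRT α T ∧ (content (length v) T ==ᴸ v))
                   (fillings (length v) α)

syrts : List ℕ → List Filling
syrts α = filterᵇ (λ T → isSSYRT α T ∧ (content (sum α) T ==ᴸ replicate (sum α) 1))
                  (fillings (sum α) α)

posIn : ℕ → List ℕ → Maybe ℕ
posIn x []       = nothing
posIn x (y ∷ ys) with x ≡ᵇ y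
... | true  = just 1
... | false with posIn x ys
...   | nothing = nothing
...   | just p  = just (suc p)

-- column containing x (0 if absent)
colOf : Filling → ℕ → ℕ
colOf []      x = 0
colOf (r ∷ T) x with posIn x r
... | just p  = p
... | nothing = colOf T x

Dhat : ℕ → Filling → List ℕ
Dhat n T = filterᵇ (λ i → colOf T i <ᵇ colOf T (suc i)) (range1 (n ∸ 1))

diffs : ℕ → List ℕ → List ℕ
diffs prev []       = []
diffs prev (x ∷ xs) = (x ∸ prev) ∷ diffs x xs

-- comp(S) = (s_1, s_2 - s_1, ..., n - s_k); for n = 0 the empty composition
compOf : ℕ → List ℕ → List ℕ
compOf zero    S = []
compOf (suc n) S = diffs 0 (S ++ [ suc n ])

dcoef : List ℕ → List ℕ → ℕ
dcoef α β = count (λ T → compOf (sum α) (Dhat (sum α) T) ==ᴸ β) (syrts α)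

incSeqs : ℕ → List ℕ → List (List ℕ)
incSeqs zero    xs       = [ [] ]
incSeqs (suc k) []       = []
incSeqs (suc k) (x ∷ xs) = map (x ∷_) (incSeqs k xs) ++ incSeqs (suc k) xs

monoExp : ℕ → List ℕ → List ℕ → List ℕ
monoExp N is γ =
  map (λ t → sum (map proj₂ (filterᵇ (λ p → proj₁ p ≡ᵇ t) (zip is γ)))) (range1 N)

-- coefficient of x^v in M_γ: number of i_1 < ... < i_k with
-- x_{i_1}^{γ_1}...x_{i_k}^{γ_k} = x^v (indices beyond N cannot contribute)
coeffM : List ℕ → List ℕ → ℕ
coeffM γ v = count (λ is → monoExp (length v) is γ ==ᴸ v)
                   (incSeqs (length γ) (range1 (length v)))

coeffF : List ℕ → List ℕ → ℕ
coeffF β v = sum (map (λ γ → coeffM γ v) (filterᵇ (λ γ → refines γ β) (comps (sum β))))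

module Submission where

-- Standardization numbers the entries of an SSYRT T of weight v by 1, …, |α|: smaller entries
-- first, and equal entries from right to left by column, bottom to top within the first column
-- and top to bottom within the others. The result σ is an SYRT, and as equal entries of T never
-- produce a reverse descent, every reverse descent of σ is a partial sum v₁ + ⋯ + vₜ.
-- Conversely every such σ is the standardization of exactly one T, recovered by replacing each
-- label by the index of the block of v containing it. So the coefficient of xᵛ in R_α counts the
-- SYRT σ with D̂(σ) among the partial sums of v, which is Σ_β d_αβ [xᵛ] F_β because [xᵛ] F_β is
-- 1 exactly when the nonzero parts of v refine β.

open import Data.Bool using (Bool; true; false; _∧_; _∨_; not; if_then_else_)
open import Data.Bool.Properties using (∨-zeroʳ; T-≡)
open import Data.Nat using (ℕ; zero; suc; _+_; _*_; _∸_; _<ᵇ_; _≤ᵇ_; _≡ᵇ_; _≤_; _<_; z≤n; s≤s; _⊓_; _≟_; _<?_; _≤?_)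
open import Data.Nat.Properties
open import Algebra.Properties.CommutativeSemigroup +-commutativeSemigroup using () renaming (interchange to +-interchange)
open import Data.Maybe as Maybe using (Maybe; just; nothing)
open import Data.Maybe.Properties using (just-injective)
open import Data.List using (List; []; _∷_; [_]; map; concat; concatMap; length; _++_; take; drop; zip; replicate; applyUpTo)
open import Data.List.Properties using (map-applyUpTo; map-++; take++drop≡id; map-cong-local; take-all; drop-all; ∷-injectiveˡ; ∷-injectiveʳ)
open import Data.Nat.ListAction using (sum)
open import Data.Nat.ListAction.Properties using (sum-++)
open import Data.Bool.ListAction using (all; any)
open import Data.List.Relation.Unary.All as All using (All; []; _∷_)
open import Data.List.Relation.Unary.All.Properties using (++⁺; ++⁻ˡ; ++⁻ʳ; map⁺; map⁻; concat⁺)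
open import Data.List.Relation.Unary.Any using (Any; here; there)
open import Data.List.Relation.Unary.AllPairs using (AllPairs; []; _∷_)
import Data.List.Relation.Unary.AllPairs.Properties as AP
open import Data.List.Membership.Propositional using (_∈_; lose)
open import Data.List.Membership.Propositional.Properties using (∈-++⁺ˡ; ∈-++⁺ʳ; ∈-++⁻; ∈-map⁺; ∈-map⁻)
open import Data.Product using (_×_; _,_; proj₁; proj₂; Σ-syntax)
open import Data.Sum using (inj₁; inj₂)
open import Data.Unit using (⊤; tt)
open import Data.Empty using (⊥; ⊥-elim)
open import Relation.Nullary using (yes; no; Dec; ¬_)
open import Relation.Binary.Definitions using (tri<; tri≈; tri>)
open import Relation.Binary.PropositionalEquality hiding ([_])
open import Function using (id; _∘_)
open import Function.Bundles using (Equivalence)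
open import Defs

⟦_⟧ : Bool → ℕ
⟦ true ⟧ = 1
⟦ false ⟧ = 0

Σ : {A : Set} → List A → (A → ℕ) → ℕ
Σ xs f = sum (map f xs)

⟦∧⟧ : ∀ a b → ⟦ a ∧ b ⟧ ≡ ⟦ a ⟧ * ⟦ b ⟧
⟦∧⟧ true b = sym (+-identityʳ _)
⟦∧⟧ false b = refl

⟦⟧≤1 : ∀ a → ⟦ a ⟧ ≤ 1
⟦⟧≤1 true = s≤s z≤n
⟦⟧≤1 false = z≤n

⟦⟧-mono : ∀ a b → (a ≡ true → b ≡ true) → ⟦ a ⟧ ≤ ⟦ b ⟧
⟦⟧-mono false b f = z≤n
⟦⟧-mono true b f rewrite f refl = ≤-refl

count-∷ : {A : Set} (p : A → Bool) (x : A) (xs : List A) → count p (x ∷ xs) ≡ ⟦ p x ⟧ + count p xs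
count-∷ p x xs with p x
... | true = refl
... | false = refl

countΣ : {A : Set} (p : A → Bool) (xs : List A) → count p xs ≡ Σ xs (λ x → ⟦ p x ⟧)
countΣ p [] = refl
countΣ p (x ∷ xs) = trans (count-∷ p x xs) (cong (⟦ p x ⟧ +_) (countΣ p xs))

filterΣ : {A : Set} (p : A → Bool) (xs : List A) (f : A → ℕ) → Σ (filterᵇ p xs) f ≡ Σ xs (λ x → ⟦ p x ⟧ * f x)
filterΣ p [] f = refl
filterΣ p (x ∷ xs) f with p x
... | true = cong₂ _+_ (sym (+-identityʳ (f x))) (filterΣ p xs f)
... | false = filterΣ p xs f

Σ-++ : {A : Set} (xs ys : List A) (f : A → ℕ) → Σ (xs ++ ys) f ≡ Σ xs f + Σ ys f
Σ-++ [] ys f = refl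
Σ-++ (x ∷ xs) ys f = trans (cong (f x +_) (Σ-++ xs ys f)) (sym (+-assoc (f x) _ _))

Σ-map : {A B : Set} (g : A → B) (xs : List A) (f : B → ℕ) → Σ (map g xs) f ≡ Σ xs (λ x → f (g x))
Σ-map g [] f = refl
Σ-map g (x ∷ xs) f = cong (f (g x) +_) (Σ-map g xs f)

Σ-concatMap : {A B : Set} (g : A → List B) (xs : List A) (f : B → ℕ) → Σ (concatMap g xs) f ≡ Σ xs (λ x → Σ (g x) f)
Σ-concatMap g [] f = refl
Σ-concatMap g (x ∷ xs) f = trans (Σ-++ (g x) (concatMap g xs) f) (cong (Σ (g x) f +_) (Σ-concatMap g xs f))

Σ-cong-local : {A : Set} {xs : List A} {f g : A → ℕ} → All (λ x → f x ≡ g x) xs → Σ xs f ≡ Σ xs g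
Σ-cong-local [] = refl
Σ-cong-local (e ∷ es) = cong₂ _+_ e (Σ-cong-local es)

Σ-cong : {A : Set} (xs : List A) {f g : A → ℕ} → (∀ x → f x ≡ g x) → Σ xs f ≡ Σ xs g
Σ-cong [] e = refl
Σ-cong (x ∷ xs) e = cong₂ _+_ (e x) (Σ-cong xs e)

Σ-+ : {A : Set} (xs : List A) (f g : A → ℕ) → Σ xs (λ x → f x + g x) ≡ Σ xs f + Σ xs g
Σ-+ [] f g = refl
Σ-+ (x ∷ xs) f g = trans (cong (f x + g x +_) (Σ-+ xs f g)) (+-interchange (f x) (g x) _ _)

Σ-*ˡ : {A : Set} (xs : List A) (c : ℕ) (f : A → ℕ) → Σ xs (λ x → c * f x) ≡ c * Σ xs f
Σ-*ˡ [] c f = sym (*-zeroʳ c)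
Σ-*ˡ (x ∷ xs) c f = trans (cong (c * f x +_) (Σ-*ˡ xs c f)) (sym (*-distribˡ-+ c (f x) _))

Σ-*ʳ : {A : Set} (xs : List A) (c : ℕ) (f : A → ℕ) → Σ xs (λ x → f x * c) ≡ Σ xs f * c
Σ-*ʳ xs c f = trans (Σ-cong xs (λ x → *-comm (f x) c)) (trans (Σ-*ˡ xs c f) (*-comm c _))

Σ-0 : {A : Set} (xs : List A) → Σ xs (λ _ → 0) ≡ 0
Σ-0 [] = refl
Σ-0 (x ∷ xs) = Σ-0 xs

Σ-swap : {A B : Set} (xs : List A) (ys : List B) (h : A → B → ℕ) →
  Σ xs (λ x → Σ ys (λ y → h x y)) ≡ Σ ys (λ y → Σ xs (λ x → h x y))
Σ-swap [] ys h = sym (Σ-0 ys)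
Σ-swap (x ∷ xs) ys h = trans (cong (Σ ys (h x) +_) (Σ-swap xs ys h)) (sym (Σ-+ ys (h x) (λ y → Σ xs (λ x′ → h x′ y))))

Σ-mono-≤ : {A : Set} {xs : List A} {f g : A → ℕ} → All (λ x → f x ≤ g x) xs → Σ xs f ≤ Σ xs g
Σ-mono-≤ [] = z≤n
Σ-mono-≤ (e ∷ es) = +-mono-≤ e (Σ-mono-≤ es)

Σ-mono-< : {A : Set} {xs : List A} {f g : A → ℕ} → All (λ x → f x ≤ g x) xs → Any (λ x → f x < g x) xs → Σ xs f < Σ xs g
Σ-mono-< (e ∷ es) (here lt) = +-mono-<-≤ lt (Σ-mono-≤ es)
Σ-mono-< (e ∷ es) (there a) = +-mono-≤-< e (Σ-mono-< es a)

Σ-one≡length : {A : Set} (xs : List A) → Σ xs (λ _ → 1) ≡ length xs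
Σ-one≡length [] = refl
Σ-one≡length (x ∷ xs) = cong suc (Σ-one≡length xs)

Σ-const : {A : Set} {xs : List A} {f : A → ℕ} (c : ℕ) → All (λ x → f x ≡ c) xs → Σ xs f ≡ length xs * c
Σ-const c [] = refl
Σ-const c (e ∷ es) = cong₂ _+_ e (Σ-const c es)

count-map : {A B : Set} (p : B → Bool) (f : A → B) (xs : List A) → count p (map f xs) ≡ count (λ x → p (f x)) xs
count-map p f xs = trans (countΣ p (map f xs)) (trans (Σ-map f xs (λ y → ⟦ p y ⟧)) (sym (countΣ _ xs)))

count-≤1 : {A : Set} {R : A → A → Set} (P : A → Bool) (L : List A) → AllPairs R L →
  (∀ x y → x ∈ L → y ∈ L → P x ≡ true → P y ≡ true → R x y → ⊥) → count P L ≤ 1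
count-≤1 P [] _ h = z≤n
count-≤1 {R = R} P (x ∷ xs) (a ∷ ap) h with P x in px
... | true = s≤s (≤-reflexive (zero-count xs a (λ y m → there m)))
  where
  zero-count : ∀ ys → All (R x) ys → (∀ y → y ∈ ys → y ∈ x ∷ xs) → count P ys ≡ 0
  zero-count [] [] _ = refl
  zero-count (y ∷ ys) (r ∷ rs) sub with P y in py
  ... | true = ⊥-elim (h x y (here refl) (sub y (here refl)) px py r)
  ... | false = zero-count ys rs (λ z m → sub z (there m))
... | false = count-≤1 P xs ap (λ x2 y2 m1 m2 → h x2 y2 (there m1) (there m2))

all-≤1⇒all≡1 : {A : Set} (xs : List A) (f : A → ℕ) → All (λ t → f t ≤ 1) xs → Σ xs f ≡ length xs → All (λ t → f t ≡ 1) xs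
all-≤1⇒all≡1 [] f [] e = []
all-≤1⇒all≡1 (x ∷ xs) f (p ∷ ps) e with f x in fx
... | suc zero = fx ∷ all-≤1⇒all≡1 xs f ps (suc-injective e)
... | suc (suc k) = ⊥-elim (≤⇒≯ p (s≤s (s≤s z≤n)))
... | zero = ⊥-elim (<-irrefl e (s≤s (≤-trans (Σ-mono-≤ ps) (≤-reflexive (Σ-one≡length xs)))))

count-∈ : {A : Set} (P : A → Bool) (L : List A) (x : A) → x ∈ L → P x ≡ true → 1 ≤ count P L
count-∈ P (y ∷ L) x (here refl) px rewrite count-∷ P y L | px = s≤s z≤n
count-∈ P (y ∷ L) x (there m) px rewrite count-∷ P y L = ≤-trans (count-∈ P L x m px) (m≤n+m _ ⟦ P y ⟧)

count-two : {A : Set} (P : A → Bool) (L : List A) (x y : A) → x ∈ L → y ∈ L → ¬ (x ≡ y) → P x ≡ true → P y ≡ true → 2 ≤ count P L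
count-two P (z ∷ L) x y (here refl) (here refl) ne px py = ⊥-elim (ne refl)
count-two P (z ∷ L) x y (here refl) (there m) ne px py rewrite count-∷ P z L | px = s≤s (count-∈ P L y m py)
count-two P (z ∷ L) x y (there m) (here refl) ne px py rewrite count-∷ P z L | py = s≤s (count-∈ P L x m px)
count-two P (z ∷ L) x y (there m1) (there m2) ne px py rewrite count-∷ P z L = ≤-trans (count-two P L x y m1 m2 ne px py) (m≤n+m _ ⟦ P z ⟧)

count-pos⇒∃ : {A : Set} (P : A → Bool) (L : List A) → 1 ≤ count P L → Σ[ x ∈ A ] (x ∈ L) × (P x ≡ true)
count-pos⇒∃ P (y ∷ L) h with P y in py
... | true = y , here refl , py
... | false = let (x , m , px) = count-pos⇒∃ P L h in x , there m , px

beq⇒≡ : ∀ m n → (m ≡ᵇ n) ≡ true → m ≡ n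
beq⇒≡ m n e = ≡ᵇ⇒≡ m n (Equivalence.from T-≡ e)

beq-refl : ∀ m → (m ≡ᵇ m) ≡ true
beq-refl m = Equivalence.to T-≡ (≡⇒≡ᵇ m m refl)

≢⇒beqF : ∀ m n → (m ≡ n → ⊥) → (m ≡ᵇ n) ≡ false
≢⇒beqF m n ne with m ≡ᵇ n in e
... | true = ⊥-elim (ne (beq⇒≡ m n e))
... | false = refl

beq-sym : ∀ m n → (m ≡ᵇ n) ≡ (n ≡ᵇ m)
beq-sym zero zero = refl
beq-sym zero (suc n) = refl
beq-sym (suc m) zero = refl
beq-sym (suc m) (suc n) = beq-sym m n

blt⇒< : ∀ m n → (m <ᵇ n) ≡ true → m < n
blt⇒< m n e = <ᵇ⇒< m n (Equivalence.from T-≡ e)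

<⇒blt : ∀ {m n} → m < n → (m <ᵇ n) ≡ true
<⇒blt m<n = Equivalence.to T-≡ (<⇒<ᵇ m<n)

ble⇒≤ : ∀ m n → (m ≤ᵇ n) ≡ true → m ≤ n
ble⇒≤ m n e = ≤ᵇ⇒≤ m n (Equivalence.from T-≡ e)

≤⇒ble : ∀ {m n} → m ≤ n → (m ≤ᵇ n) ≡ true
≤⇒ble m≤n = Equivalence.to T-≡ (≤⇒≤ᵇ m≤n)

≥⇒bltF : ∀ {m n} → n ≤ m → (m <ᵇ n) ≡ false
≥⇒bltF {m} {n} n≤m with m <ᵇ n in e
... | true = ⊥-elim (≤⇒≯ n≤m (blt⇒< m n e))
... | false = refl

>⇒bleF : ∀ {m n} → n < m → (m ≤ᵇ n) ≡ false
>⇒bleF {m} {n} n<m with m ≤ᵇ n in e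
... | true = ⊥-elim (<⇒≱ n<m (ble⇒≤ m n e))
... | false = refl

<ᵇ-suc≡≤ᵇ : ∀ t y → (t <ᵇ suc y) ≡ (t ≤ᵇ y)
<ᵇ-suc≡≤ᵇ zero y = refl
<ᵇ-suc≡≤ᵇ (suc t) y = refl

suc-≤ᵇ-suc : ∀ t y → (suc t ≤ᵇ suc y) ≡ (t ≤ᵇ y)
suc-≤ᵇ-suc zero y = refl
suc-≤ᵇ-suc (suc t) y = refl

true≢false : true ≢ false
true≢false ()

nothing≢just : ∀ {a : ℕ} → nothing ≢ just a
nothing≢just ()

∧-elim : ∀ {a b} → (a ∧ b) ≡ true → (a ≡ true) × (b ≡ true)
∧-elim {true} {true} _ = refl , refl

∧₃-elim : ∀ {a b c} → (a ∧ b ∧ c) ≡ true → (a ≡ true) × (b ≡ true) × (c ≡ true)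
∧₃-elim {true} {true} {true} _ = refl , refl , refl

∧-intro : ∀ {a b} → a ≡ true → b ≡ true → (a ∧ b) ≡ true
∧-intro refl refl = refl

all-elim : {A : Set} (p : A → Bool) (xs : List A) → all p xs ≡ true → All (λ x → p x ≡ true) xs
all-elim p [] e = []
all-elim p (x ∷ xs) e = let (e1 , e2) = ∧-elim {p x} e in e1 ∷ all-elim p xs e2

all-intro : {A : Set} (p : A → Bool) (xs : List A) → All (λ x → p x ≡ true) xs → all p xs ≡ true
all-intro p [] [] = refl
all-intro p (x ∷ xs) (e ∷ es) = ∧-intro e (all-intro p xs es)

implies-elim : ∀ {a b} → (not a ∨ b) ≡ true → a ≡ true → b ≡ true
implies-elim {true} e _ = e

implies-intro : ∀ {a b} → (a ≡ true → b ≡ true) → (not a ∨ b) ≡ true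
implies-intro {true} f = f refl
implies-intro {false} f = refl

≡-byTrue : ∀ b c → (b ≡ true → c ≡ true) → (c ≡ true → b ≡ true) → b ≡ c
≡-byTrue true true f g = refl
≡-byTrue true false f g = sym (f refl)
≡-byTrue false true f g = g refl
≡-byTrue false false f g = refl

≤pred⇒< : ∀ {k m} → 1 ≤ k → k ≤ m ∸ 1 → k < m
≤pred⇒< {suc k} {suc m} _ k≤m = s≤s k≤m

interval : ℕ → ℕ → List ℕ
interval s zero = []
interval s (suc m) = s ∷ interval (suc s) m

range1≡interval : ∀ n → range1 n ≡ interval 1 n
range1≡interval n = trans (map-applyUpTo id suc n) (applyUpTo≡interval suc 1 n (λ i → refl))
  where
  applyUpTo≡interval : (f : ℕ → ℕ) (s m : ℕ) → (∀ i → f i ≡ s + i) → applyUpTo f m ≡ interval s m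
  applyUpTo≡interval f s zero h = refl
  applyUpTo≡interval f s (suc m) h =
    cong₂ _∷_ (trans (h 0) (+-identityʳ s)) (applyUpTo≡interval (λ i → f (suc i)) (suc s) m (λ i → trans (h (suc i)) (+-suc s i)))

all-range1⁺ : (p : ℕ → Bool) (n : ℕ) → (∀ i → 1 ≤ i → i ≤ n → p i ≡ true) → all p (range1 n) ≡ true
all-range1⁺ p n h rewrite range1≡interval n = go 1 n (λ i s≤i i<s+m → h i (≤-trans (s≤s z≤n) s≤i) (≤-pred i<s+m))
  where
  go : ∀ s m → (∀ i → s ≤ i → i < s + m → p i ≡ true) → all p (interval s m) ≡ true
  go s zero _ = refl
  go s (suc m) hh = ∧-intro (hh s ≤-refl (m<m+n s (s≤s z≤n)))
    (go (suc s) m (λ i p q → hh i (≤-trans (n≤1+n s) p) (<-≤-trans q (≤-reflexive (sym (+-suc s m))))))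

inIntervalᵇ : ℕ → ℕ → ℕ → Bool
inIntervalᵇ s m x = (s ≤ᵇ x) ∧ (x <ᵇ s + m)

inIntervalᵇ⁻ : ∀ s m a → inIntervalᵇ s m a ≡ true → (s ≤ a) × (a < s + m)
inIntervalᵇ⁻ s m a e = let (e1 , e2) = ∧-elim {s ≤ᵇ a} e in ble⇒≤ s a e1 , blt⇒< a (s + m) e2

inIntervalᵇ⁺ : ∀ {s m a} → s ≤ a → a < s + m → inIntervalᵇ s m a ≡ true
inIntervalᵇ⁺ p q = ∧-intro (≤⇒ble p) (<⇒blt q)

Σ-interval-≡ᵇ : ∀ s m a → Σ (interval s m) (λ x → ⟦ x ≡ᵇ a ⟧) ≡ ⟦ inIntervalᵇ s m a ⟧
Σ-interval-≡ᵇ s zero a = cong ⟦_⟧ (≡-byTrue false (inIntervalᵇ s zero a) (λ ()) (λ e → let (p , q) = inIntervalᵇ⁻ s zero a e in ⊥-elim (<-irrefl refl (<-≤-trans q (≤-trans (≤-reflexive (+-identityʳ s)) p)))))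
Σ-interval-≡ᵇ s (suc m) a with s ≟ a
... | yes refl rewrite beq-refl s = trans (cong suc (trans (Σ-interval-≡ᵇ (suc s) m s) (cong ⟦_⟧ s∉tail))) (cong ⟦_⟧ (sym s∈interval))
  where
  s∉tail : inIntervalᵇ (suc s) m s ≡ false
  s∉tail = sym (≡-byTrue false _ (λ ()) (λ e → ⊥-elim (<-irrefl refl (proj₁ (inIntervalᵇ⁻ (suc s) m s e)))))
  s∈interval : inIntervalᵇ s (suc m) s ≡ true
  s∈interval = inIntervalᵇ⁺ ≤-refl (m<m+n s (s≤s z≤n))
... | no ne rewrite ≢⇒beqF s a ne = trans (Σ-interval-≡ᵇ (suc s) m a) (cong ⟦_⟧ (≡-byTrue _ _ f g))
  where
  f : inIntervalᵇ (suc s) m a ≡ true → inIntervalᵇ s (suc m) a ≡ true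
  f e = let (p , q) = inIntervalᵇ⁻ (suc s) m a e in inIntervalᵇ⁺ (≤-trans (n≤1+n s) p) (<-≤-trans q (≤-reflexive (sym (+-suc s m))))
  g : inIntervalᵇ s (suc m) a ≡ true → inIntervalᵇ (suc s) m a ≡ true
  g e = let (p , q) = inIntervalᵇ⁻ s (suc m) a e in inIntervalᵇ⁺ (≤∧≢⇒< p ne) (<-≤-trans q (≤-reflexive (+-suc s m)))

interval-lowerBound : ∀ s m → All (λ t → s ≤ t) (interval s m)
interval-lowerBound s zero = []
interval-lowerBound s (suc m) = ≤-refl ∷ All.map (λ p → ≤-trans (n≤1+n s) p) (interval-lowerBound (suc s) m)

length-interval : ∀ s m → length (interval s m) ≡ m
length-interval s zero = refl
length-interval s (suc m) = cong suc (length-interval (suc s) m)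

All-interval : ∀ s m → All (λ x → inIntervalᵇ s m x ≡ true) (interval s m)
All-interval s zero = []
All-interval s (suc m) = inIntervalᵇ⁺ ≤-refl (m<m+n s (s≤s z≤n)) ∷ All.map (λ {x} e → let (p , q) = inIntervalᵇ⁻ (suc s) m x e in inIntervalᵇ⁺ (≤-trans (n≤1+n s) p) (<-≤-trans q (≤-reflexive (sym (+-suc s m))))) (All-interval (suc s) m)

∈-interval⁺ : ∀ s m i → s ≤ i → i < s + m → i ∈ interval s m
∈-interval⁺ s zero i p q = ⊥-elim (<-irrefl refl (<-≤-trans q (≤-trans (≤-reflexive (+-identityʳ s)) p)))
∈-interval⁺ s (suc m) i p q with s ≟ i
... | yes refl = here refl
... | no ne = there (∈-interval⁺ (suc s) m i (≤∧≢⇒< p ne) (<-≤-trans q (≤-reflexive (+-suc s m))))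

interval-++ : ∀ s a m → interval s (a + m) ≡ interval s a ++ interval (s + a) m
interval-++ s zero m rewrite +-identityʳ s = refl
interval-++ s (suc a) m = cong (s ∷_) (trans (interval-++ (suc s) a m) (cong (λ z → interval (suc s) a ++ interval z m) (sym (+-suc s a))))

interval-shift : ∀ k s m → interval (s + k) m ≡ map (_+ k) (interval s m)
interval-shift k s zero = refl
interval-shift k s (suc m) = cong (s + k ∷_) (interval-shift k (suc s) m)

interval-suc : ∀ s m → interval (suc s) m ≡ map suc (interval s m)
interval-suc s zero = refl
interval-suc s (suc m) = cong (suc s ∷_) (interval-suc (suc s) m)

Σ-interval-<ᵇ : ∀ s m ℓ → Σ (interval s m) (λ t → ⟦ t <ᵇ ℓ ⟧) ≡ (ℓ ∸ s) ⊓ m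
Σ-interval-<ᵇ s zero ℓ = sym (⊓-zeroʳ (ℓ ∸ s))
Σ-interval-<ᵇ s (suc m) ℓ with s <? ℓ
... | yes p rewrite <⇒blt p | Σ-interval-<ᵇ (suc s) m ℓ = cong (_⊓ suc m) (sym (trans (cong (_∸ s) (sym (m+[n∸m]≡n p))) (trans (cong (_∸ s) (sym (+-suc s (ℓ ∸ suc s)))) (m+n∸m≡n s (suc (ℓ ∸ suc s))))))
... | no p rewrite ≥⇒bltF {s} {ℓ} (≮⇒≥ p) | Σ-interval-<ᵇ (suc s) m ℓ | m≤n⇒m∸n≡0 (≮⇒≥ p) | m≤n⇒m∸n≡0 (≤-trans (≮⇒≥ p) (n≤1+n s)) = refl

inRange1ᵇ : ℕ → ℕ → Bool
inRange1ᵇ N x = inIntervalᵇ 1 N x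

Σ-range1-≡ᵇ : ∀ N a → Σ (range1 N) (λ x → ⟦ x ≡ᵇ a ⟧) ≡ ⟦ inRange1ᵇ N a ⟧
Σ-range1-≡ᵇ N a rewrite range1≡interval N = Σ-interval-≡ᵇ 1 N a

All-range1 : ∀ N → All (λ x → inRange1ᵇ N x ≡ true) (range1 N)
All-range1 N rewrite range1≡interval N = All-interval 1 N

∈-range1⁺ : ∀ n i → 1 ≤ i → i ≤ n → i ∈ range1 n
∈-range1⁺ n i p q rewrite range1≡interval n = ∈-interval⁺ 1 n i p (s≤s q)

∈-range1⁻ : ∀ n i → i ∈ range1 n → (1 ≤ i) × (i ≤ n)
∈-range1⁻ n i m with All.lookup (All-range1 n) m
... | e = let (p , q) = inIntervalᵇ⁻ 1 n i e in p , ≤-pred q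

Σ-range1-<ᵇ : ∀ n ℓ → 1 ≤ ℓ → ℓ ≤ n → Σ (range1 n) (λ t → ⟦ t <ᵇ ℓ ⟧) ≡ ℓ ∸ 1
Σ-range1-<ᵇ n ℓ p q rewrite range1≡interval n | Σ-interval-<ᵇ 1 n ℓ = m≤n⇒m⊓n≡m (≤-trans (m∸n≤m ℓ 1) q)

map-const1 : ∀ n → map (λ _ → 1) (range1 n) ≡ replicate n 1
map-const1 n = trans (cong (map (λ _ → 1)) (range1≡interval n)) (go 1 n)
  where
  go : ∀ s m → map (λ _ → 1) (interval s m) ≡ replicate m 1
  go s zero = refl
  go s (suc m) = cong (1 ∷_) (go (suc s) m)

all-range1⁻ : (p : ℕ → Bool) (n : ℕ) → all p (range1 n) ≡ true → ∀ i → 1 ≤ i → i ≤ n → p i ≡ true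
all-range1⁻ p n e i a b = All.lookup (all-elim p (range1 n) e) (∈-range1⁺ n i a b)

==ᴸ-sound : ∀ u w → (u ==ᴸ w) ≡ true → u ≡ w
==ᴸ-sound [] [] e = refl
==ᴸ-sound (x ∷ u) (y ∷ w) e = let (e1 , e2) = ∧-elim {x ≡ᵇ y} e in cong₂ _∷_ (beq⇒≡ x y e1) (==ᴸ-sound u w e2)
==ᴸ-sound [] (y ∷ w) ()
==ᴸ-sound (x ∷ u) [] ()

==ᴸ-refl : ∀ u → (u ==ᴸ u) ≡ true
==ᴸ-refl [] = refl
==ᴸ-refl (x ∷ u) rewrite beq-refl x = ==ᴸ-refl u

==ᴸ-sym : ∀ u w → (u ==ᴸ w) ≡ (w ==ᴸ u)
==ᴸ-sym u w = ≡-byTrue _ _ (λ e → subst (λ z → (w ==ᴸ z) ≡ true) (sym (==ᴸ-sound u w e)) (==ᴸ-refl w))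
                         (λ e → subst (λ z → (u ==ᴸ z) ≡ true) (sym (==ᴸ-sound w u e)) (==ᴸ-refl u))

⟦==ᴸ⟧-subst : ∀ (u w : List ℕ) (f : List ℕ → ℕ) → ⟦ u ==ᴸ w ⟧ * f u ≡ ⟦ u ==ᴸ w ⟧ * f w
⟦==ᴸ⟧-subst u w f with u ==ᴸ w in e
... | true rewrite ==ᴸ-sound u w e = refl
... | false = refl

isVecᵇ : ℕ → ℕ → List ℕ → Bool
isVecᵇ N ℓ w = (length w ≡ᵇ ℓ) ∧ all (inRange1ᵇ N) w

vecs-multiplicity : ∀ N ℓ w → Σ (vecs N ℓ) (λ u → ⟦ u ==ᴸ w ⟧) ≡ ⟦ isVecᵇ N ℓ w ⟧
vecs-multiplicity N zero [] = refl
vecs-multiplicity N zero (a ∷ w) = refl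
vecs-multiplicity N (suc ℓ) [] = trans (Σ-concatMap (λ x → map (x ∷_) (vecs N ℓ)) (range1 N) (λ u → ⟦ u ==ᴸ [] ⟧))
  (trans (Σ-cong (range1 N) (λ x → trans (Σ-map (x ∷_) (vecs N ℓ) (λ u → ⟦ u ==ᴸ [] ⟧)) (Σ-0 (vecs N ℓ)))) (Σ-0 (range1 N)))
vecs-multiplicity N (suc ℓ) (a ∷ w) =
  begin
    Σ (concatMap (λ x → map (x ∷_) (vecs N ℓ)) (range1 N)) (λ u → ⟦ u ==ᴸ (a ∷ w) ⟧)
  ≡⟨ Σ-concatMap (λ x → map (x ∷_) (vecs N ℓ)) (range1 N) _ ⟩
    Σ (range1 N) (λ x → Σ (map (x ∷_) (vecs N ℓ)) (λ u → ⟦ u ==ᴸ (a ∷ w) ⟧))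
  ≡⟨ Σ-cong (range1 N) (λ x → trans (Σ-map (x ∷_) (vecs N ℓ) _) (trans (Σ-cong (vecs N ℓ) (λ u → ⟦∧⟧ (x ≡ᵇ a) (u ==ᴸ w))) (Σ-*ˡ (vecs N ℓ) ⟦ x ≡ᵇ a ⟧ (λ u → ⟦ u ==ᴸ w ⟧)))) ⟩
    Σ (range1 N) (λ x → ⟦ x ≡ᵇ a ⟧ * Σ (vecs N ℓ) (λ u → ⟦ u ==ᴸ w ⟧))
  ≡⟨ Σ-*ʳ (range1 N) _ (λ x → ⟦ x ≡ᵇ a ⟧) ⟩
    Σ (range1 N) (λ x → ⟦ x ≡ᵇ a ⟧) * Σ (vecs N ℓ) (λ u → ⟦ u ==ᴸ w ⟧)
  ≡⟨ cong₂ _*_ (Σ-range1-≡ᵇ N a) (vecs-multiplicity N ℓ w) ⟩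
    ⟦ inRange1ᵇ N a ⟧ * ⟦ isVecᵇ N ℓ w ⟧
  ≡⟨ ⟦⟧-∧-rotate (length w ≡ᵇ ℓ) (inRange1ᵇ N a) (all (inRange1ᵇ N) w) ⟩
    ⟦ isVecᵇ N (suc ℓ) (a ∷ w) ⟧
  ∎
  where
  open ≡-Reasoning
  ⟦⟧-∧-rotate : ∀ x y z → ⟦ y ⟧ * ⟦ x ∧ z ⟧ ≡ ⟦ x ∧ (y ∧ z) ⟧
  ⟦⟧-∧-rotate true true z = +-identityʳ _
  ⟦⟧-∧-rotate true false z = refl
  ⟦⟧-∧-rotate false true z = refl
  ⟦⟧-∧-rotate false false z = refl

All-vecs-isVec : ∀ N ℓ → All (λ u → isVecᵇ N ℓ u ≡ true) (vecs N ℓ)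
All-vecs-isVec N zero = refl ∷ []
All-vecs-isVec N (suc ℓ) = concat⁺ (map⁺
  (All.map (λ {x} ix → map⁺ (All.map (λ {u} e → let (e1 , e2) = ∧-elim {length u ≡ᵇ ℓ} e in ∧-intro e1 (∧-intro ix e2)) (All-vecs-isVec N ℓ))) (All-range1 N)))

eqFilling : Filling → Filling → Bool
eqFilling [] [] = true
eqFilling (r ∷ S) (r2 ∷ S2) = (r ==ᴸ r2) ∧ eqFilling S S2
eqFilling _ _ = false

eqFilling-sound : ∀ S S2 → eqFilling S S2 ≡ true → S ≡ S2
eqFilling-sound [] [] e = refl
eqFilling-sound (r ∷ S) (r2 ∷ S2) e = let (e1 , e2) = ∧-elim {r ==ᴸ r2} e in cong₂ _∷_ (==ᴸ-sound r r2 e1) (eqFilling-sound S S2 e2)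
eqFilling-sound [] (_ ∷ _) ()
eqFilling-sound (_ ∷ _) [] ()

eqFilling-refl : ∀ S → eqFilling S S ≡ true
eqFilling-refl [] = refl
eqFilling-refl (r ∷ S) rewrite ==ᴸ-refl r = eqFilling-refl S

isFillingᵇ : ℕ → List ℕ → Filling → Bool
isFillingᵇ N [] [] = true
isFillingᵇ N (a ∷ α) (r ∷ S) = isVecᵇ N a r ∧ isFillingᵇ N α S
isFillingᵇ N _ _ = false

fillings-multiplicity : ∀ N α S → Σ (fillings N α) (λ T → ⟦ eqFilling T S ⟧) ≡ ⟦ isFillingᵇ N α S ⟧
fillings-multiplicity N [] [] = refl
fillings-multiplicity N [] (_ ∷ _) = refl
fillings-multiplicity N (a ∷ α) [] = trans (Σ-concatMap (λ r → map (r ∷_) (fillings N α)) (vecs N a) (λ T → ⟦ eqFilling T [] ⟧))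
  (trans (Σ-cong (vecs N a) (λ r → trans (Σ-map (r ∷_) (fillings N α) (λ T → ⟦ eqFilling T [] ⟧)) (Σ-0 (fillings N α)))) (Σ-0 (vecs N a)))
fillings-multiplicity N (a ∷ α) (r0 ∷ S) =
  begin
    Σ (concatMap (λ r → map (r ∷_) (fillings N α)) (vecs N a)) (λ T → ⟦ eqFilling T (r0 ∷ S) ⟧)
  ≡⟨ Σ-concatMap (λ r → map (r ∷_) (fillings N α)) (vecs N a) _ ⟩
    Σ (vecs N a) (λ r → Σ (map (r ∷_) (fillings N α)) (λ T → ⟦ eqFilling T (r0 ∷ S) ⟧))
  ≡⟨ Σ-cong (vecs N a) (λ r → trans (Σ-map (r ∷_) (fillings N α) _) (trans (Σ-cong (fillings N α) (λ T → ⟦∧⟧ (r ==ᴸ r0) (eqFilling T S))) (Σ-*ˡ (fillings N α) ⟦ r ==ᴸ r0 ⟧ (λ T → ⟦ eqFilling T S ⟧)))) ⟩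
    Σ (vecs N a) (λ r → ⟦ r ==ᴸ r0 ⟧ * Σ (fillings N α) (λ T → ⟦ eqFilling T S ⟧))
  ≡⟨ Σ-*ʳ (vecs N a) _ (λ r → ⟦ r ==ᴸ r0 ⟧) ⟩
    Σ (vecs N a) (λ r → ⟦ r ==ᴸ r0 ⟧) * Σ (fillings N α) (λ T → ⟦ eqFilling T S ⟧)
  ≡⟨ cong₂ _*_ (vecs-multiplicity N a r0) (fillings-multiplicity N α S) ⟩
    ⟦ isVecᵇ N a r0 ⟧ * ⟦ isFillingᵇ N α S ⟧
  ≡⟨ sym (⟦∧⟧ (isVecᵇ N a r0) (isFillingᵇ N α S)) ⟩
    ⟦ isFillingᵇ N (a ∷ α) (r0 ∷ S) ⟧
  ∎
  where open ≡-Reasoning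

All-fillings-isFilling : ∀ N α → All (λ T → isFillingᵇ N α T ≡ true) (fillings N α)
All-fillings-isFilling N [] = refl ∷ []
All-fillings-isFilling N (a ∷ α) = concat⁺ (map⁺
  (All.map (λ {r} ok → map⁺ (All.map (λ {T} v → ∧-intro ok v) (All-fillings-isFilling N α))) (All-vecs-isVec N a)))

All-filter : {A : Set} {P : A → Set} (p : A → Bool) {xs : List A} → All P xs → All (λ x → (p x ≡ true) × P x) (filterᵇ p xs)
All-filter p {[]} [] = []
All-filter p {x ∷ xs} (a ∷ as) with p x in e
... | true = (e , a) ∷ All-filter p as
... | false = All-filter p as

isCompᵇ : ℕ → List ℕ → Bool
isCompᵇ n c = (all (inRange1ᵇ n) c ∧ (length c <ᵇ suc n)) ∧ (sum c ≡ᵇ n)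

comps-multiplicity : ∀ n c → Σ (comps n) (λ γ → ⟦ γ ==ᴸ c ⟧) ≡ ⟦ isCompᵇ n c ⟧
comps-multiplicity n c =
  begin
    Σ (comps n) (λ γ → ⟦ γ ==ᴸ c ⟧)
  ≡⟨ filterΣ (λ γ → sum γ ≡ᵇ n) L _ ⟩
    Σ L (λ γ → ⟦ sum γ ≡ᵇ n ⟧ * ⟦ γ ==ᴸ c ⟧)
  ≡⟨ Σ-cong L (λ γ → trans (*-comm ⟦ sum γ ≡ᵇ n ⟧ _) (⟦==ᴸ⟧-subst γ c (λ z → ⟦ sum z ≡ᵇ n ⟧))) ⟩
    Σ L (λ γ → ⟦ γ ==ᴸ c ⟧ * ⟦ sum c ≡ᵇ n ⟧)
  ≡⟨ Σ-*ʳ L _ (λ γ → ⟦ γ ==ᴸ c ⟧) ⟩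
    Σ L (λ γ → ⟦ γ ==ᴸ c ⟧) * ⟦ sum c ≡ᵇ n ⟧
  ≡⟨ cong (_* ⟦ sum c ≡ᵇ n ⟧) (Σ-concatMap (vecs n) (0 ∷ range1 n) (λ γ → ⟦ γ ==ᴸ c ⟧)) ⟩
    Σ (0 ∷ range1 n) (λ ℓ → Σ (vecs n ℓ) (λ γ → ⟦ γ ==ᴸ c ⟧)) * ⟦ sum c ≡ᵇ n ⟧
  ≡⟨ cong (_* ⟦ sum c ≡ᵇ n ⟧) (Σ-cong (0 ∷ range1 n) (λ ℓ → trans (vecs-multiplicity n ℓ c) (trans (⟦∧⟧ (length c ≡ᵇ ℓ) _) (cong (_* ⟦ all (inRange1ᵇ n) c ⟧) (cong ⟦_⟧ (beq-sym (length c) ℓ)))))) ⟩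
    Σ (0 ∷ range1 n) (λ ℓ → ⟦ ℓ ≡ᵇ length c ⟧ * ⟦ all (inRange1ᵇ n) c ⟧) * ⟦ sum c ≡ᵇ n ⟧
  ≡⟨ cong (_* ⟦ sum c ≡ᵇ n ⟧) (Σ-*ʳ (0 ∷ range1 n) _ (λ ℓ → ⟦ ℓ ≡ᵇ length c ⟧)) ⟩
    Σ (0 ∷ range1 n) (λ ℓ → ⟦ ℓ ≡ᵇ length c ⟧) * ⟦ all (inRange1ᵇ n) c ⟧ * ⟦ sum c ≡ᵇ n ⟧
  ≡⟨ cong (λ z → Σ z (λ ℓ → ⟦ ℓ ≡ᵇ length c ⟧) * ⟦ all (inRange1ᵇ n) c ⟧ * ⟦ sum c ≡ᵇ n ⟧) (cong (0 ∷_) (range1≡interval n)) ⟩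
    Σ (interval 0 (suc n)) (λ ℓ → ⟦ ℓ ≡ᵇ length c ⟧) * ⟦ all (inRange1ᵇ n) c ⟧ * ⟦ sum c ≡ᵇ n ⟧
  ≡⟨ cong (λ z → z * ⟦ all (inRange1ᵇ n) c ⟧ * ⟦ sum c ≡ᵇ n ⟧) (Σ-interval-≡ᵇ 0 (suc n) (length c)) ⟩
    ⟦ length c <ᵇ suc n ⟧ * ⟦ all (inRange1ᵇ n) c ⟧ * ⟦ sum c ≡ᵇ n ⟧
  ≡⟨ cong (_* ⟦ sum c ≡ᵇ n ⟧) (trans (*-comm ⟦ length c <ᵇ suc n ⟧ _) (sym (⟦∧⟧ (all (inRange1ᵇ n) c) _))) ⟩
    ⟦ all (inRange1ᵇ n) c ∧ (length c <ᵇ suc n) ⟧ * ⟦ sum c ≡ᵇ n ⟧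
  ≡⟨ sym (⟦∧⟧ _ (sum c ≡ᵇ n)) ⟩
    ⟦ isCompᵇ n c ⟧
  ∎
  where
  open ≡-Reasoning
  L : List (List ℕ)
  L = concatMap (vecs n) (0 ∷ range1 n)

All-comps : ∀ n → All (λ γ → ((sum γ ≡ᵇ n) ≡ true) × (all (inRange1ᵇ n) γ ≡ true)) (comps n)
All-comps n = All.map (λ {γ} (e , ok) → e , proj₂ (∧-elim {length γ ≡ᵇ length γ} ok))
  (All-filter (λ γ → sum γ ≡ᵇ n) (concat⁺ (map⁺ (vecs-ofOwnLength (0 ∷ range1 n)))))
  where
  vecs-ofOwnLength : ∀ ls → All (λ ℓ → All (λ u → isVecᵇ n (length u) u ≡ true) (vecs n ℓ)) ls
  vecs-ofOwnLength [] = []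
  vecs-ofOwnLength (ℓ ∷ ls) = All.map (λ {u} e → ∧-intro (beq-refl (length u)) (proj₂ (∧-elim {length u ≡ᵇ ℓ} e))) (All-vecs-isVec n ℓ) ∷ vecs-ofOwnLength ls

-- The coefficients of M_γ and F_β

filter-false : {A : Set} (p : A → Bool) (x : A) (xs : List A) → p x ≡ false → filterᵇ p (x ∷ xs) ≡ filterᵇ p xs
filter-false p x xs e rewrite e = refl

filter-true : {A : Set} (p : A → Bool) (x : A) (xs : List A) → p x ≡ true → filterᵇ p (x ∷ xs) ≡ x ∷ filterᵇ p xs
filter-true p x xs e rewrite e = refl

exponentOf : ℕ → List ℕ → List ℕ → ℕ
exponentOf t is γ = sum (map proj₂ (filterᵇ (λ p → proj₁ p ≡ᵇ t) (zip is γ)))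

exponentOf-hit : ∀ i is g γ → exponentOf i (i ∷ is) (g ∷ γ) ≡ g + exponentOf i is γ
exponentOf-hit i is g γ rewrite filter-true (λ p → proj₁ p ≡ᵇ i) (i , g) (zip is γ) (beq-refl i) = refl

exponentOf-miss : ∀ t i is g γ → (i ≡ᵇ t) ≡ false → exponentOf t (i ∷ is) (g ∷ γ) ≡ exponentOf t is γ
exponentOf-miss t i is g γ e rewrite filter-false (λ p → proj₁ p ≡ᵇ t) (i , g) (zip is γ) e = refl

exponentOf-none : ∀ t is γ → All (λ i → (i ≡ᵇ t) ≡ false) is → exponentOf t is γ ≡ 0
exponentOf-none t [] γ _ = refl
exponentOf-none t (i ∷ is) [] _ = refl
exponentOf-none t (i ∷ is) (g ∷ γ) (e ∷ es) = trans (exponentOf-miss t i is g γ e) (exponentOf-none t is γ es)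

Positive : List ℕ → Set
Positive = All (λ g → 0 < g)

dropZeros : List ℕ → List ℕ
dropZeros [] = []
dropZeros (zero ∷ v) = dropZeros v
dropZeros (suc a ∷ v) = suc a ∷ dropZeros v

All-incSeqs : {P : ℕ → Set} (k : ℕ) (xs : List ℕ) → All P xs → All (All P) (incSeqs k xs)
All-incSeqs zero xs a = [] ∷ []
All-incSeqs (suc k) [] [] = []
All-incSeqs (suc k) (x ∷ xs) (px ∷ a) = ++⁺ (map⁺ (All.map (px ∷_) (All-incSeqs k xs a))) (All-incSeqs (suc k) xs a)

<⇒beqF : ∀ {m n} → m < n → (n ≡ᵇ m) ≡ false
<⇒beqF {m} {n} lt = ≢⇒beqF n m (λ e → <-irrefl (sym e) lt)

monoExpOn : List ℕ → List ℕ → List ℕ → List ℕ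
monoExpOn xs is γ = map (λ t → exponentOf t is γ) xs

coeffMOn : ℕ → List ℕ → List ℕ → ℕ
coeffMOn s γ v = Σ (incSeqs (length γ) (interval s (length v))) (λ is → ⟦ monoExpOn (interval s (length v)) is γ ==ᴸ v ⟧)

coeffMOn-indicator : ∀ s γ v → Positive γ → coeffMOn s γ v ≡ ⟦ γ ==ᴸ dropZeros v ⟧
coeffMOn-indicator s [] [] _ = refl
coeffMOn-indicator s (g ∷ γ) [] _ = refl
coeffMOn-indicator s [] (a ∷ v) _ =
  trans (+-identityʳ _) (trans (⟦∧⟧ (0 ≡ᵇ a) _) (trans (cong (⟦ 0 ≡ᵇ a ⟧ *_) (trans (sym (+-identityʳ _)) (coeffMOn-indicator (suc s) [] v []))) (dropZeros-cons-[] a)))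
  where
  dropZeros-cons-[] : ∀ a → ⟦ 0 ≡ᵇ a ⟧ * ⟦ [] ==ᴸ dropZeros v ⟧ ≡ ⟦ [] ==ᴸ dropZeros (a ∷ v) ⟧
  dropZeros-cons-[] zero = +-identityʳ _
  dropZeros-cons-[] (suc a) = refl
coeffMOn-indicator s (g ∷ γ) (a ∷ v) (pg ∷ pγ) =
  begin
    Σ (map (s ∷_) (incSeqs (length γ) xs) ++ incSeqs (suc (length γ)) xs) matches
  ≡⟨ Σ-++ (map (s ∷_) (incSeqs (length γ) xs)) _ matches ⟩
    Σ (map (s ∷_) (incSeqs (length γ) xs)) matches + Σ (incSeqs (suc (length γ)) xs) matches
  ≡⟨ cong₂ _+_ (trans (Σ-map (s ∷_) (incSeqs (length γ) xs) matches) (Σ-cong-local starts-at-s)) (Σ-cong-local avoids-s) ⟩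
    Σ (incSeqs (length γ) xs) (λ is → ⟦ g ≡ᵇ a ⟧ * ⟦ monoExpOn xs is γ ==ᴸ v ⟧) + Σ (incSeqs (suc (length γ)) xs) (λ is → ⟦ 0 ≡ᵇ a ⟧ * ⟦ monoExpOn xs is (g ∷ γ) ==ᴸ v ⟧)
  ≡⟨ cong₂ _+_ (trans (Σ-*ˡ (incSeqs (length γ) xs) ⟦ g ≡ᵇ a ⟧ (λ is → ⟦ monoExpOn xs is γ ==ᴸ v ⟧)) (cong (⟦ g ≡ᵇ a ⟧ *_) (coeffMOn-indicator (suc s) γ v pγ))) (trans (Σ-*ˡ (incSeqs (suc (length γ)) xs) ⟦ 0 ≡ᵇ a ⟧ (λ is → ⟦ monoExpOn xs is (g ∷ γ) ==ᴸ v ⟧)) (cong (⟦ 0 ≡ᵇ a ⟧ *_) (coeffMOn-indicator (suc s) (g ∷ γ) v (pg ∷ pγ)))) ⟩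
    ⟦ g ≡ᵇ a ⟧ * ⟦ γ ==ᴸ dropZeros v ⟧ + ⟦ 0 ≡ᵇ a ⟧ * ⟦ (g ∷ γ) ==ᴸ dropZeros v ⟧
  ≡⟨ dropZeros-cons a g pg ⟩
    ⟦ (g ∷ γ) ==ᴸ dropZeros (a ∷ v) ⟧
  ∎
  where
  open ≡-Reasoning
  xs : List ℕ
  xs = interval (suc s) (length v)
  matches : List ℕ → ℕ
  matches is = ⟦ monoExpOn (s ∷ xs) is (g ∷ γ) ==ᴸ (a ∷ v) ⟧
  xs>s : All (λ t → suc s ≤ t) xs
  xs>s = interval-lowerBound (suc s) (length v)
  starts-at-s : All (λ is → matches (s ∷ is) ≡ ⟦ g ≡ᵇ a ⟧ * ⟦ monoExpOn xs is γ ==ᴸ v ⟧) (incSeqs (length γ) xs)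
  starts-at-s = All.map (λ {is} ais →
      trans (cong₂ (λ x y → ⟦ (x ≡ᵇ a) ∧ (y ==ᴸ v) ⟧)
               (trans (exponentOf-hit s is g γ) (trans (cong (g +_) (exponentOf-none s is γ (All.map (λ p → <⇒beqF p) ais))) (+-identityʳ g)))
               (map-cong-local (All.map (λ {t} p → exponentOf-miss t s is g γ (trans (beq-sym s t) (<⇒beqF p))) xs>s)))
            (⟦∧⟧ (g ≡ᵇ a) _))
    (All-incSeqs (length γ) xs xs>s)
  avoids-s : All (λ is → matches is ≡ ⟦ 0 ≡ᵇ a ⟧ * ⟦ monoExpOn xs is (g ∷ γ) ==ᴸ v ⟧) (incSeqs (suc (length γ)) xs)
  avoids-s = All.map (λ {is} ais →
      trans (cong (λ x → ⟦ (x ≡ᵇ a) ∧ (monoExpOn xs is (g ∷ γ) ==ᴸ v) ⟧) (exponentOf-none s is (g ∷ γ) (All.map (λ p → <⇒beqF p) ais)))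
            (⟦∧⟧ (0 ≡ᵇ a) _))
    (All-incSeqs (suc (length γ)) xs xs>s)
  dropZeros-cons : ∀ a g → 0 < g → ⟦ g ≡ᵇ a ⟧ * ⟦ γ ==ᴸ dropZeros v ⟧ + ⟦ 0 ≡ᵇ a ⟧ * ⟦ (g ∷ γ) ==ᴸ dropZeros v ⟧ ≡ ⟦ (g ∷ γ) ==ᴸ dropZeros (a ∷ v) ⟧
  dropZeros-cons zero (suc g) _ = +-identityʳ _
  dropZeros-cons (suc a) (suc g) _ = trans (+-identityʳ _) (sym (⟦∧⟧ (g ≡ᵇ a) _))

coeffM-indicator : ∀ γ v → Positive γ → coeffM γ v ≡ ⟦ γ ==ᴸ dropZeros v ⟧
coeffM-indicator γ v pγ = trans (countΣ _ (incSeqs (length γ) (range1 (length v))))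
  (trans (cong (λ xs → Σ (incSeqs (length γ) xs) (λ is → ⟦ monoExpOn xs is γ ==ᴸ v ⟧)) (range1≡interval (length v))) (coeffMOn-indicator 1 γ v pγ))

sum-dropZeros : ∀ v → sum (dropZeros v) ≡ sum v
sum-dropZeros [] = refl
sum-dropZeros (zero ∷ v) = sum-dropZeros v
sum-dropZeros (suc a ∷ v) = cong (suc a +_) (sum-dropZeros v)

dropZeros-positive : ∀ v → Positive (dropZeros v)
dropZeros-positive [] = []
dropZeros-positive (zero ∷ v) = dropZeros-positive v
dropZeros-positive (suc a ∷ v) = s≤s z≤n ∷ dropZeros-positive v

len≤sum : ∀ xs → Positive xs → length xs ≤ sum xs
len≤sum [] [] = z≤n
len≤sum (x ∷ xs) (p ∷ ps) = +-mono-≤ p (len≤sum xs ps)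

elem≤sum : ∀ xs → All (λ g → g ≤ sum xs) xs
elem≤sum [] = []
elem≤sum (x ∷ xs) = m≤m+n x (sum xs) ∷ All.map (λ p → ≤-trans p (m≤n+m (sum xs) x)) (elem≤sum xs)

positive-parts-inRange : ∀ {n} xs → Positive xs → sum xs ≡ n → All (λ x → inRange1ᵇ n x ≡ true) xs
positive-parts-inRange xs pos refl = go xs pos (elem≤sum xs)
  where
  go : ∀ ys → Positive ys → All (λ g → g ≤ sum xs) ys → All (λ x → inRange1ᵇ (sum xs) x ≡ true) ys
  go [] [] [] = []
  go (y ∷ ys) (p ∷ ps) (q ∷ qs) = inIntervalᵇ⁺ p (s≤s q) ∷ go ys ps qs

positive-isCompᵇ : ∀ {n} c → Positive c → sum c ≡ n → isCompᵇ n c ≡ true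
positive-isCompᵇ {n} c pos refl =
  ∧-intro (∧-intro (all-intro (inRange1ᵇ n) c (positive-parts-inRange c pos refl)) (<⇒blt (s≤s (len≤sum c pos))))
          (beq-refl (sum c))

isCompᵇ-dropZeros : ∀ n v → isCompᵇ n (dropZeros v) ≡ (sum v ≡ᵇ n)
isCompᵇ-dropZeros n v = ≡-byTrue _ _ f g
  where
  f : isCompᵇ n (dropZeros v) ≡ true → (sum v ≡ᵇ n) ≡ true
  f e = subst (λ z → (z ≡ᵇ n) ≡ true) (sum-dropZeros v) (proj₂ (∧-elim {all (inRange1ᵇ n) (dropZeros v) ∧ (length (dropZeros v) <ᵇ suc n)} e))
  g : (sum v ≡ᵇ n) ≡ true → isCompᵇ n (dropZeros v) ≡ true
  g e = positive-isCompᵇ (dropZeros v) (dropZeros-positive v) (trans (sum-dropZeros v) (beq⇒≡ _ _ e))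

coeffF-indicator : ∀ β v → coeffF β v ≡ ⟦ sum v ≡ᵇ sum β ⟧ * ⟦ refines (dropZeros v) β ⟧
coeffF-indicator β v =
  begin
    coeffF β v
  ≡⟨ filterΣ (λ γ → refines γ β) (comps n) (λ γ → coeffM γ v) ⟩
    Σ (comps n) (λ γ → ⟦ refines γ β ⟧ * coeffM γ v)
  ≡⟨ Σ-cong-local (All.map (λ {γ} (e , ok) → trans (cong (⟦ refines γ β ⟧ *_) (coeffM-indicator γ v (pos γ ok))) (trans (*-comm ⟦ refines γ β ⟧ _) (⟦==ᴸ⟧-subst γ (dropZeros v) (λ z → ⟦ refines z β ⟧)))) (All-comps n)) ⟩
    Σ (comps n) (λ γ → ⟦ γ ==ᴸ dropZeros v ⟧ * ⟦ refines (dropZeros v) β ⟧)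
  ≡⟨ Σ-*ʳ (comps n) _ (λ γ → ⟦ γ ==ᴸ dropZeros v ⟧) ⟩
    Σ (comps n) (λ γ → ⟦ γ ==ᴸ dropZeros v ⟧) * ⟦ refines (dropZeros v) β ⟧
  ≡⟨ cong (_* ⟦ refines (dropZeros v) β ⟧) (trans (comps-multiplicity n (dropZeros v)) (cong ⟦_⟧ (isCompᵇ-dropZeros n v))) ⟩
    ⟦ sum v ≡ᵇ n ⟧ * ⟦ refines (dropZeros v) β ⟧
  ∎
  where
  open ≡-Reasoning
  n = sum β
  pos : ∀ γ → all (inRange1ᵇ n) γ ≡ true → Positive γ
  pos γ ok = All.map (λ {x} e → proj₁ (inIntervalᵇ⁻ 1 n x e)) (all-elim (inRange1ᵇ n) γ ok)

-- Refinement and partial sums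

isPartialSumᵇ : List ℕ → ℕ → Bool
isPartialSumᵇ γ zero = true
isPartialSumᵇ [] (suc m) = false
isPartialSumᵇ (g ∷ γ) (suc m) = (g ≤ᵇ suc m) ∧ isPartialSumᵇ γ (suc m ∸ g)

isPartialSum-drop⁺ : ∀ γ i m → Positive γ → isPartialSumᵇ (drop i γ) m ≡ true → isPartialSumᵇ γ (sum (take i γ) + m) ≡ true
isPartialSum-drop⁺ γ zero m _ h = h
isPartialSum-drop⁺ [] (suc i) m _ h = h
isPartialSum-drop⁺ (suc g ∷ γ) (suc i) m (_ ∷ pγ) h rewrite +-assoc g (sum (take i γ)) m =
  ∧-intro (<⇒blt (s≤s (m≤m+n g _))) (subst (λ z → isPartialSumᵇ γ z ≡ true) (sym (m+n∸m≡n g _)) (isPartialSum-drop⁺ γ i m pγ h))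

isPartialSum-drop⁻ : ∀ γ i m → Positive γ → isPartialSumᵇ γ (sum (take i γ) + m) ≡ true → isPartialSumᵇ (drop i γ) m ≡ true
isPartialSum-drop⁻ γ zero m _ h = h
isPartialSum-drop⁻ [] (suc i) m _ h = h
isPartialSum-drop⁻ (suc g ∷ γ) (suc i) m (_ ∷ pγ) h rewrite +-assoc g (sum (take i γ)) m =
  isPartialSum-drop⁻ γ i m pγ (subst (λ z → isPartialSumᵇ γ z ≡ true) (m+n∸m≡n g _) (proj₂ (∧-elim {g <ᵇ suc (g + (sum (take i γ) + m))} h)))

isPartialSum-take : ∀ γ i → Positive γ → isPartialSumᵇ γ (sum (take i γ)) ≡ true
isPartialSum-take γ i pγ = subst (λ z → isPartialSumᵇ γ z ≡ true) (+-identityʳ (sum (take i γ))) (isPartialSum-drop⁺ γ i 0 pγ refl)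

isPartialSum⇒take : ∀ γ m → Positive γ → isPartialSumᵇ γ (suc m) ≡ true → Σ[ i ∈ ℕ ] (1 ≤ i) × (i ≤ length γ) × (sum (take i γ) ≡ suc m)
isPartialSum⇒take [] m _ ()
isPartialSum⇒take (g ∷ γ) m (pg ∷ pγ) h with ∧-elim {g ≤ᵇ suc m} h
... | h1 , h2 with suc m ∸ g in e
...   | zero = 1 , ≤-refl , s≤s z≤n , trans (+-identityʳ g) (≤-antisym (ble⇒≤ g (suc m) h1) (m∸n≡0⇒m≤n e))
...   | suc k = let (i , i1 , i2 , p3) = isPartialSum⇒take γ k pγ h2 in suc i , s≤s z≤n , s≤s i2 ,
          trans (cong (g +_) p3) (trans (cong (g +_) (sym e)) (m+[n∸m]≡n (ble⇒≤ g (suc m) h1)))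

Ascending : ℕ → List ℕ → Set
Ascending p [] = ⊤
Ascending p (s ∷ L) = (p < s) × Ascending s L

Ascending-weaken : ∀ {q p} L → q ≤ p → Ascending p L → Ascending q L
Ascending-weaken [] _ _ = tt
Ascending-weaken (s ∷ L) qp (ps , r) = ≤-<-trans qp ps , r

Ascending-lowerBound : ∀ p L → Ascending p L → All (λ s → p < s) L
Ascending-lowerBound p [] _ = []
Ascending-lowerBound p (s ∷ L) (ps , r) = ps ∷ All.map (λ x → <-trans ps x) (Ascending-lowerBound s L r)

Ascending-++⁻ˡ : ∀ {p} S {e} → Ascending p (S ++ [ e ]) → Ascending p S
Ascending-++⁻ˡ [] _ = tt
Ascending-++⁻ˡ (x ∷ S) (a , b) = a , Ascending-++⁻ˡ S b

refines-cons : ∀ γ b β → refines γ (b ∷ β) ≡ any (λ i → (sum (take i γ) ≡ᵇ b) ∧ refines (drop i γ) β) (range1 (length γ))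
refines-cons [] b β = refl
refines-cons (x ∷ γ) b β = refl

any-elim : {A : Set} (p : A → Bool) (xs : List A) → any p xs ≡ true → Σ[ x ∈ A ] (x ∈ xs) × (p x ≡ true)
any-elim p (x ∷ xs) e with p x in ex
... | true = x , here refl , ex
... | false = let (y , m , ey) = any-elim p xs e in y , there m , ey

any-intro : {A : Set} (p : A → Bool) (xs : List A) (x : A) → x ∈ xs → p x ≡ true → any p xs ≡ true
any-intro p (y ∷ xs) x (here refl) e rewrite e = refl
any-intro p (y ∷ xs) x (there m) e with p y
... | true = refl
... | false = any-intro p xs x m e

Positive-drop : ∀ γ i → Positive γ → Positive (drop i γ)
Positive-drop γ zero p = p
Positive-drop [] (suc i) p = p
Positive-drop (x ∷ γ) (suc i) (_ ∷ p) = Positive-drop γ i p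

sum-take-drop : ∀ i (γ : List ℕ) → sum γ ≡ sum (take i γ) + sum (drop i γ)
sum-take-drop i γ = trans (cong sum (sym (take++drop≡id i γ))) (sum-++ (take i γ) (drop i γ))

refines-diffs⇒partialSums : ∀ γ p S → Positive γ → Ascending p (S ++ [ p + sum γ ]) → refines γ (diffs p (S ++ [ p + sum γ ])) ≡ true → All (λ s → isPartialSumᵇ γ (s ∸ p) ≡ true) S
refines-diffs⇒partialSums γ p [] _ _ _ = []
refines-diffs⇒partialSums γ p (s ∷ S) pγ (ps , inc) h with any-elim _ (range1 (length γ)) (trans (sym (refines-cons γ (s ∸ p) (diffs s (S ++ [ p + sum γ ])))) h)
... | i , mi , hi =
  let (h1 , h2) = ∧-elim {sum (take i γ) ≡ᵇ (s ∸ p)} hi in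
  let e1 = beq⇒≡ _ _ h1 in
  let eL : p + sum γ ≡ s + sum (drop i γ)
      eL = trans (cong (p +_) (sum-take-drop i γ)) (trans (sym (+-assoc p _ _)) (cong (_+ sum (drop i γ)) (trans (cong (p +_) e1) (m+[n∸m]≡n (<⇒≤ ps))))) in
  let IH = refines-diffs⇒partialSums (drop i γ) s S (Positive-drop γ i pγ) (subst (λ z → Ascending s (S ++ [ z ])) eL inc) (subst (λ z → refines (drop i γ) (diffs s (S ++ [ z ])) ≡ true) eL h2) in
  subst (λ z → isPartialSumᵇ γ z ≡ true) e1 (isPartialSum-take γ i pγ) ∷
  shift-partialSums S (Ascending-lowerBound s S (Ascending-++⁻ˡ S inc)) IH e1
  where
  shift-partialSums : ∀ S2 → All (λ s2 → s < s2) S2 → All (λ s2 → isPartialSumᵇ (drop i γ) (s2 ∸ s) ≡ true) S2 → sum (take i γ) ≡ s ∸ p → All (λ s2 → isPartialSumᵇ γ (s2 ∸ p) ≡ true) S2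
  shift-partialSums [] [] [] _ = []
  shift-partialSums (s2 ∷ S2) (lt ∷ lts) (h ∷ hs) e1 = subst (λ z → isPartialSumᵇ γ z ≡ true) eq (isPartialSum-drop⁺ γ i (s2 ∸ s) pγ h) ∷ shift-partialSums S2 lts hs e1
    where
    eq : sum (take i γ) + (s2 ∸ s) ≡ s2 ∸ p
    eq = trans (cong (_+ (s2 ∸ s)) e1) (trans (sym (+-∸-comm {s} (s2 ∸ s) (<⇒≤ ps))) (cong (_∸ p) (m+[n∸m]≡n (<⇒≤ lt))))

partialSums⇒refines-diffs : ∀ γ p S → Positive γ → Ascending p (S ++ [ p + sum γ ]) → All (λ s → isPartialSumᵇ γ (s ∸ p) ≡ true) S → refines γ (diffs p (S ++ [ p + sum γ ])) ≡ true
partialSums⇒refines-diffs [] p [] _ (lt , _) [] = ⊥-elim (<-irrefl (sym (+-identityʳ p)) lt)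
partialSums⇒refines-diffs (g ∷ γ) p [] pγ _ [] rewrite m+n∸m≡n p (sum (g ∷ γ)) =
  any-intro _ (range1 (length (g ∷ γ))) (length (g ∷ γ)) (∈-range1⁺ _ _ (s≤s z≤n) ≤-refl)
    (∧-intro (subst (λ z → (sum z ≡ᵇ sum (g ∷ γ)) ≡ true) (sym (take-all (length (g ∷ γ)) (g ∷ γ) ≤-refl)) (beq-refl (sum (g ∷ γ))))
             (subst (λ z → refines z [] ≡ true) (sym (drop-all (length (g ∷ γ)) (g ∷ γ) ≤-refl)) refl))
partialSums⇒refines-diffs γ p (s ∷ S) pγ (ps , inc) (h ∷ hs) with s ∸ p in esp
... | zero = ⊥-elim (<-irrefl refl (<-≤-trans ps (m∸n≡0⇒m≤n esp)))
... | suc k =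
  let (i , i1 , i2 , ei) = isPartialSum⇒take γ k pγ h in
  let eL : p + sum γ ≡ s + sum (drop i γ)
      eL = trans (cong (p +_) (sum-take-drop i γ)) (trans (sym (+-assoc p _ _)) (cong (_+ sum (drop i γ)) (trans (cong (p +_) (trans ei (sym esp))) (m+[n∸m]≡n (<⇒≤ ps))))) in
  let IH = partialSums⇒refines-diffs (drop i γ) s S (Positive-drop γ i pγ) (subst (λ z → Ascending s (S ++ [ z ])) eL inc) (unshift-partialSums S {i} (Ascending-lowerBound s S (Ascending-++⁻ˡ S inc)) hs ei) in
  trans (refines-cons γ (suc k) _)
    (any-intro _ (range1 (length γ)) i (∈-range1⁺ _ _ i1 i2)
      (∧-intro (subst (λ z → (sum (take i γ) ≡ᵇ z) ≡ true) ei (beq-refl (sum (take i γ))))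
               (subst (λ z → refines (drop i γ) (diffs s (S ++ [ z ])) ≡ true) (sym eL) IH)))
  where
  unshift-partialSums : ∀ S2 {i} → All (λ s2 → s < s2) S2 → All (λ s2 → isPartialSumᵇ γ (s2 ∸ p) ≡ true) S2 → sum (take i γ) ≡ suc k → All (λ s2 → isPartialSumᵇ (drop i γ) (s2 ∸ s) ≡ true) S2
  unshift-partialSums [] [] [] _ = []
  unshift-partialSums (s2 ∷ S2) {i} (lt ∷ lts) (h ∷ hs) e1 = isPartialSum-drop⁻ γ i (s2 ∸ s) pγ (subst (λ z → isPartialSumᵇ γ z ≡ true) (sym eq) h) ∷ unshift-partialSums S2 {i} lts hs e1
    where
    eq : sum (take i γ) + (s2 ∸ s) ≡ s2 ∸ p
    eq = trans (cong (_+ (s2 ∸ s)) (trans e1 (sym esp))) (trans (sym (+-∸-comm {s} (s2 ∸ s) (<⇒≤ ps))) (cong (_∸ p) (m+[n∸m]≡n (<⇒≤ lt))))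

Ascending-interval : ∀ q s k → q < s → Ascending q (interval s k ++ [ s + k ])
Ascending-interval q s zero lt = subst (q <_) (sym (+-identityʳ s)) lt , tt
Ascending-interval q s (suc k) lt = lt , subst (λ z → Ascending s (interval (suc s) k ++ [ z ])) (sym (+-suc s k)) (Ascending-interval s (suc s) k ≤-refl)

Ascending-filter : ∀ (d : ℕ → Bool) q xs e → Ascending q (xs ++ [ e ]) → Ascending q (filterᵇ d xs ++ [ e ])
Ascending-filter d q [] e h = h
Ascending-filter d q (x ∷ xs) e (lt , h) with d x
... | true = lt , Ascending-filter d x xs e h
... | false = Ascending-filter d q xs e (Ascending-weaken (xs ++ [ e ]) (<⇒≤ lt) h)

All-filter⁺ : ∀ {P : ℕ → Set} (d : ℕ → Bool) xs → (∀ x → x ∈ xs → d x ≡ true → P x) → All P (filterᵇ d xs)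
All-filter⁺ d [] h = []
All-filter⁺ d (x ∷ xs) h with d x in e
... | true = h x (here refl) e ∷ All-filter⁺ d xs (λ y m → h y (there m))
... | false = All-filter⁺ d xs (λ y m → h y (there m))

All-filter⁻ : ∀ {P : ℕ → Set} (d : ℕ → Bool) xs → All P (filterᵇ d xs) → ∀ x → x ∈ xs → d x ≡ true → P x
All-filter⁻ d (y ∷ xs) a x m dx with d y in e
All-filter⁻ d (y ∷ xs) (p ∷ a) x (here refl) dx | true = p
All-filter⁻ d (y ∷ xs) (p ∷ a) x (there m) dx | true = All-filter⁻ d xs a x m dx
All-filter⁻ d (y ∷ xs) a x (here refl) dx | false = ⊥-elim (true≢false (trans (sym dx) e))
All-filter⁻ d (y ∷ xs) a x (there m) dx | false = All-filter⁻ d xs a x m dx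

Ascending-filter-range1 : ∀ (d : ℕ → Bool) m → Ascending 0 (filterᵇ d (range1 m) ++ [ suc m ])
Ascending-filter-range1 d m = Ascending-filter d 0 (range1 m) (suc m) (subst (λ z → Ascending 0 (z ++ [ suc m ])) (sym (range1≡interval m)) (Ascending-interval 0 1 m (s≤s z≤n)))

Ascending-last : ∀ s S e → Ascending s (S ++ [ e ]) → s < e
Ascending-last s [] e (lt , _) = lt
Ascending-last s (x ∷ S) e (lt , inc) = <-trans lt (Ascending-last x S e inc)

sum-diffs : ∀ p S e → Ascending p (S ++ [ e ]) → sum (diffs p (S ++ [ e ])) ≡ e ∸ p
sum-diffs p [] e (lt , _) = +-identityʳ _
sum-diffs p (s ∷ S) e (lt , inc) =
  trans (cong (s ∸ p +_) (sum-diffs s S e inc))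
  (trans (+-comm (s ∸ p) (e ∸ s))
  (trans (sym (+-∸-assoc (e ∸ s) (<⇒≤ lt)))
  (cong (_∸ p) (m∸n+n≡m (<⇒≤ (Ascending-last s S e inc))))))

diffs-positive : ∀ p S e → Ascending p (S ++ [ e ]) → Positive (diffs p (S ++ [ e ]))
diffs-positive p [] e (lt , _) = m<n⇒0<n∸m lt ∷ []
diffs-positive p (s ∷ S) e (lt , inc) = m<n⇒0<n∸m lt ∷ diffs-positive s S e inc

compOf-isComp : ∀ n S → Ascending 0 (S ++ [ n ]) → (isCompᵇ n (compOf n S) ≡ true) × (sum (compOf n S) ≡ n)
compOf-isComp zero S _ = refl , refl
compOf-isComp (suc m) S inc = positive-isCompᵇ c pos sc , sc
  where
  c : List ℕ
  c = diffs 0 (S ++ [ suc m ])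
  sc : sum c ≡ suc m
  sc = sum-diffs 0 S (suc m) inc
  pos : Positive c
  pos = diffs-positive 0 S (suc m) inc

compOf-filter-isComp : ∀ (d : ℕ → Bool) n → (isCompᵇ n (compOf n (filterᵇ d (range1 (n ∸ 1)))) ≡ true) × (sum (compOf n (filterᵇ d (range1 (n ∸ 1)))) ≡ n)
compOf-filter-isComp d zero = refl , refl
compOf-filter-isComp d (suc m) = compOf-isComp (suc m) _ (Ascending-filter-range1 d m)

Positive-sum≡0 : ∀ γ → Positive γ → sum γ ≡ 0 → γ ≡ []
Positive-sum≡0 [] _ _ = refl
Positive-sum≡0 (suc g ∷ γ) _ ()
Positive-sum≡0 (zero ∷ γ) (() ∷ _) _

refines-compOf⇒partialSums : ∀ γ n d → Positive γ → sum γ ≡ n → refines γ (compOf n (filterᵇ d (range1 (n ∸ 1)))) ≡ true → ∀ i → 1 ≤ i → i < n → d i ≡ true → isPartialSumᵇ γ i ≡ true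
refines-compOf⇒partialSums γ (suc m) d pγ es h i i1 i2 di =
  All-filter⁻ d (range1 m) partialSums i (∈-range1⁺ m i i1 (≤-pred i2)) di
  where
  S : List ℕ
  S = filterᵇ d (range1 m)
  inc : Ascending 0 (S ++ [ 0 + sum γ ])
  inc = subst (λ z → Ascending 0 (S ++ [ z ])) (sym es) (Ascending-filter-range1 d m)
  partialSums : All (λ s → isPartialSumᵇ γ s ≡ true) S
  partialSums = refines-diffs⇒partialSums γ 0 S pγ inc (subst (λ z → refines γ (diffs 0 (S ++ [ z ])) ≡ true) (sym es) h)

partialSums⇒refines-compOf : ∀ γ n d → Positive γ → sum γ ≡ n → (∀ i → 1 ≤ i → i < n → d i ≡ true → isPartialSumᵇ γ i ≡ true) → refines γ (compOf n (filterᵇ d (range1 (n ∸ 1)))) ≡ true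
partialSums⇒refines-compOf γ zero d pγ es h rewrite Positive-sum≡0 γ pγ es = refl
partialSums⇒refines-compOf γ (suc m) d pγ es h =
  subst (λ z → refines γ (diffs 0 (S ++ [ z ])) ≡ true) es (partialSums⇒refines-diffs γ 0 S pγ inc partialSums)
  where
  S : List ℕ
  S = filterᵇ d (range1 m)
  inc : Ascending 0 (S ++ [ 0 + sum γ ])
  inc = subst (λ z → Ascending 0 (S ++ [ z ])) (sym es) (Ascending-filter-range1 d m)
  partialSums : All (λ s → isPartialSumᵇ γ (s ∸ 0) ≡ true) S
  partialSums = All-filter⁺ d (range1 m) (λ x mx dx → let (p , q) = ∈-range1⁻ m x mx in h x p (s≤s q) dx)

-- block v ℓ is the letter t with v₁ + ⋯ + v₍ₜ₋₁₎ < ℓ ≤ v₁ + ⋯ + vₜ, i.e. the value that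
-- destandardization with respect to the weight v gives to the standard label ℓ.
block : List ℕ → ℕ → ℕ
block [] ℓ = 1
block (a ∷ v) ℓ = if ℓ ≤ᵇ a then 1 else suc (block v (ℓ ∸ a))

block-≤ : ∀ a v ℓ → ℓ ≤ a → block (a ∷ v) ℓ ≡ 1
block-≤ a v ℓ p rewrite ≤⇒ble p = refl

block-> : ∀ a v ℓ → a < ℓ → block (a ∷ v) ℓ ≡ suc (block v (ℓ ∸ a))
block-> a v ℓ p rewrite >⇒bleF p = refl

block-positive : ∀ v ℓ → 1 ≤ block v ℓ
block-positive [] ℓ = s≤s z≤n
block-positive (a ∷ v) ℓ with ℓ ≤ᵇ a
... | true = s≤s z≤n
... | false = s≤s z≤n

block-mono : ∀ v {ℓ ℓ2} → ℓ ≤ ℓ2 → block v ℓ ≤ block v ℓ2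
block-mono [] p = ≤-refl
block-mono (a ∷ v) {ℓ} {ℓ2} p with ℓ2 ≤? a
... | yes q rewrite block-≤ a v ℓ (≤-trans p q) | block-≤ a v ℓ2 q = ≤-refl
... | no q with ℓ ≤? a
...   | yes r rewrite block-≤ a v ℓ r | block-> a v ℓ2 (≰⇒> q) = s≤s z≤n
...   | no r rewrite block-> a v ℓ (≰⇒> r) | block-> a v ℓ2 (≰⇒> q) = s≤s (block-mono v (∸-monoˡ-≤ a p))

block-≮⇒≡ : ∀ v {ℓ ℓ′} → ℓ ≤ ℓ′ → ¬ (block v ℓ < block v ℓ′) → block v ℓ ≡ block v ℓ′
block-≮⇒≡ v ℓ≤ℓ′ b≮ = ≤-antisym (block-mono v ℓ≤ℓ′) (≮⇒≥ b≮)

block-bound : ∀ v ℓ → 1 ≤ ℓ → ℓ ≤ sum v → block v ℓ ≤ length v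
block-bound [] ℓ p q = ⊥-elim (<-irrefl refl (≤-trans p q))
block-bound (a ∷ v) ℓ p q with ℓ ≤? a
... | yes r rewrite block-≤ a v ℓ r = s≤s z≤n
... | no r rewrite block-> a v ℓ (≰⇒> r) = s≤s (block-bound v (ℓ ∸ a) (m<n⇒0<n∸m (≰⇒> r)) (≤-trans (∸-monoˡ-≤ a q) (≤-reflexive (m+n∸m≡n a (sum v)))))

block-between-partialSums : ∀ v y ℓ → y < length v → sum (take y v) < ℓ → ℓ ≤ sum (take (suc y) v) → block v ℓ ≡ suc y
block-between-partialSums (a ∷ v) zero ℓ _ p q = block-≤ a v ℓ (≤-trans q (≤-reflexive (+-identityʳ a)))
block-between-partialSums (a ∷ v) (suc y) ℓ (s≤s yl) p q =
  trans (block-> a v ℓ (≤-<-trans (m≤m+n a _) p))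
        (cong suc (block-between-partialSums v y (ℓ ∸ a) yl (+-cancelˡ-< a _ _ (<-≤-trans p (≤-reflexive (sym (m+[n∸m]≡n (≤-trans (m≤m+n a _) (<⇒≤ p))))))) (≤-trans (∸-monoˡ-≤ a q) (≤-reflexive (m+n∸m≡n a _)))))

block-step≡isPartialSum : ∀ v i → 1 ≤ i → (block v i <ᵇ block v (suc i)) ≡ isPartialSumᵇ (dropZeros v) i
block-step≡isPartialSum [] (suc i) p = refl
block-step≡isPartialSum (zero ∷ v) (suc i) p = block-step≡isPartialSum v (suc i) (s≤s z≤n)
block-step≡isPartialSum (suc a ∷ v) (suc i) p with suc i ≤? a
... | yes q rewrite block-≤ (suc a) v (suc i) (≤-trans q (n≤1+n a)) | block-≤ (suc a) v (suc (suc i)) (s≤s q) | >⇒bleF {suc a} {suc i} (s≤s q) = refl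
... | no q with i ≟ a
...   | yes refl rewrite block-≤ (suc a) v (suc a) ≤-refl | block-> (suc a) v (suc (suc a)) ≤-refl | n∸n≡0 a = trans (<⇒blt (block-positive v (suc a ∸ a))) (sym (∧-intro (<⇒blt (n<1+n a)) refl))
...   | no r =
  let a<i : a < i
      a<i = ≤∧≢⇒< (≤-pred (≰⇒> q)) (λ e → r (sym e)) in
  trans (cong₂ _<ᵇ_ (block-> (suc a) v (suc i) (s≤s a<i)) (block-> (suc a) v (suc (suc i)) (s≤s (≤-trans a<i (n≤1+n i)))))
  (trans (cong₂ (λ x y → block v x <ᵇ block v y) refl (+-∸-assoc 1 {i} {a} (≤-trans (n≤1+n a) a<i)))
   (trans (block-step≡isPartialSum v (i ∸ a) (m<n⇒0<n∸m a<i)) (sym (trans (cong (_∧ isPartialSumᵇ (dropZeros v) (i ∸ a)) (<⇒blt {a} {suc i} (≤-trans a<i (n≤1+n i)))) refl))))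

-- The 1-based entry vₜ, and 0 outside 1 ≤ t ≤ length v.
entry : List ℕ → ℕ → ℕ
entry [] t = 0
entry (a ∷ v) zero = 0
entry (a ∷ v) (suc zero) = a
entry (a ∷ v) (suc (suc t)) = entry v (suc t)

map-entry-interval : ∀ a v s m → map (entry (a ∷ v)) (interval (suc (suc s)) m) ≡ map (entry v) (interval (suc s) m)
map-entry-interval a v s zero = refl
map-entry-interval a v s (suc m) = cong (entry v (suc s) ∷_) (map-entry-interval a v (suc s) m)

map-entry : ∀ v → map (entry v) (range1 (length v)) ≡ v
map-entry v = trans (cong (map (entry v)) (range1≡interval (length v))) (go v)
  where
  go : ∀ v → map (entry v) (interval 1 (length v)) ≡ v
  go [] = refl
  go (a ∷ v) = cong (a ∷_) (trans (map-entry-interval a v 0 (length v)) (go v))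

block-fibre : ∀ v t → 1 ≤ t → Σ (range1 (sum v)) (λ ℓ → ⟦ block v ℓ ≡ᵇ t ⟧) ≡ entry v t
block-fibre v t pt = trans (cong (λ z → Σ z (λ ℓ → ⟦ block v ℓ ≡ᵇ t ⟧)) (range1≡interval (sum v))) (fibre v t pt)
  where
  fibre : ∀ v t → 1 ≤ t → Σ (interval 1 (sum v)) (λ ℓ → ⟦ block v ℓ ≡ᵇ t ⟧) ≡ entry v t
  fibre [] (suc t) _ = refl
  fibre (a ∷ v) (suc t) _ =
    begin
      Σ (interval 1 (a + sum v)) f
    ≡⟨ cong (λ z → Σ z f) (interval-++ 1 a (sum v)) ⟩
      Σ (interval 1 a ++ interval (1 + a) (sum v)) f
    ≡⟨ Σ-++ (interval 1 a) _ f ⟩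
      Σ (interval 1 a) f + Σ (interval (1 + a) (sum v)) f
    ≡⟨ cong₂ _+_ (trans (Σ-const ⟦ 1 ≡ᵇ suc t ⟧ (All.map (λ {ℓ} e → cong (λ z → ⟦ z ≡ᵇ suc t ⟧) (block-≤ a v ℓ (≤-pred (proj₂ (inIntervalᵇ⁻ 1 a ℓ e))))) (All-interval 1 a))) (cong (_* ⟦ 1 ≡ᵇ suc t ⟧) (length-interval 1 a)))
                 (trans (cong (λ z → Σ z f) (interval-shift a 1 (sum v))) (trans (Σ-map (_+ a) (interval 1 (sum v)) f)
                   (Σ-cong-local (All.map (λ {ℓ} e → cong (λ z → ⟦ z ≡ᵇ suc t ⟧) (trans (block-> a v (ℓ + a) (+-monoˡ-≤ a (proj₁ (inIntervalᵇ⁻ 1 (sum v) ℓ e)))) (cong (λ z → suc (block v z)) (m+n∸n≡m ℓ a)))) (All-interval 1 (sum v)))))) ⟩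
      a * ⟦ 1 ≡ᵇ suc t ⟧ + Σ (interval 1 (sum v)) (λ ℓ → ⟦ suc (block v ℓ) ≡ᵇ suc t ⟧)
    ≡⟨ first-block-split t ⟩
      entry (a ∷ v) (suc t)
    ∎
    where
    open ≡-Reasoning
    f : ℕ → ℕ
    f ℓ = ⟦ block (a ∷ v) ℓ ≡ᵇ suc t ⟧
    first-block-split : ∀ t → a * ⟦ 1 ≡ᵇ suc t ⟧ + Σ (interval 1 (sum v)) (λ ℓ → ⟦ suc (block v ℓ) ≡ᵇ suc t ⟧) ≡ entry (a ∷ v) (suc t)
    first-block-split zero = trans (cong₂ _+_ (*-identityʳ a) (trans (Σ-cong (interval 1 (sum v)) block≢0) (Σ-0 (interval 1 (sum v))))) (+-identityʳ a)
      where
      block≢0 : ∀ ℓ → ⟦ block v ℓ ≡ᵇ 0 ⟧ ≡ 0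
      block≢0 ℓ with block v ℓ | block-positive v ℓ
      ... | suc b | _ = refl
    first-block-split (suc t) = trans (cong (_+ Σ (interval 1 (sum v)) (λ ℓ → ⟦ block v ℓ ≡ᵇ suc t ⟧)) (*-zeroʳ a)) (fibre v (suc t) (s≤s z≤n))

record Cell : Set where
  constructor mkC
  field
    rw : ℕ
    cl : ℕ
    vl : ℕ
open Cell public

rowCells : ℕ → ℕ → List ℕ → List Cell
rowCells r c [] = []
rowCells r c (x ∷ xs) = mkC r c x ∷ rowCells r (suc c) xs

cellsFrom : ℕ → Filling → List Cell
cellsFrom r [] = []
cellsFrom r (row ∷ T) = rowCells r 1 row ++ cellsFrom (suc r) T

cellsOf : Filling → List Cell
cellsOf = cellsFrom 1

relRow : (ℕ → ℕ → ℕ → ℕ) → ℕ → ℕ → List ℕ → List ℕ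
relRow f r c [] = []
relRow f r c (x ∷ xs) = f r c x ∷ relRow f r (suc c) xs

relRows : (ℕ → ℕ → ℕ → ℕ) → ℕ → Filling → Filling
relRows f r [] = []
relRows f r (row ∷ T) = relRow f r 1 row ∷ relRows f (suc r) T

relabel : (ℕ → ℕ → ℕ → ℕ) → Filling → Filling
relabel f T = relRows f 1 T

bindM : {A : Set} → Maybe A → (A → Maybe ℕ) → Maybe ℕ
bindM nothing g = nothing
bindM (just a) g = g a

cell-bind : ∀ T i j → cell T (suc i) (suc j) ≡ bindM (nth T i) (λ row → nth row j)
cell-bind T i j with nth T i
... | nothing = refl
... | just row = refl

nth-relRow : ∀ f r c row j → nth (relRow f r c row) j ≡ Maybe.map (f r (c + j)) (nth row j)
nth-relRow f r c [] j = refl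
nth-relRow f r c (x ∷ xs) zero = cong (λ z → just (f r z x)) (sym (+-identityʳ c))
nth-relRow f r c (x ∷ xs) (suc j) = trans (nth-relRow f r (suc c) xs j) (cong (λ z → Maybe.map (f r z) (nth xs j)) (sym (+-suc c j)))

nth-relRows : ∀ f r T i → nth (relRows f r T) i ≡ Maybe.map (relRow f (r + i) 1) (nth T i)
nth-relRows f r [] i = refl
nth-relRows f r (row ∷ T) zero = cong (λ z → just (relRow f z 1 row)) (sym (+-identityʳ r))
nth-relRows f r (row ∷ T) (suc i) = trans (nth-relRows f (suc r) T i) (cong (λ z → Maybe.map (relRow f z 1) (nth T i)) (sym (+-suc r i)))

cell-rel : ∀ f T i j → cell (relabel f T) i j ≡ Maybe.map (f i j) (cell T i j)
cell-rel f T zero j = refl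
cell-rel f T (suc i) zero = refl
cell-rel f T (suc i) (suc j) rewrite cell-bind (relabel f T) i j | cell-bind T i j | nth-relRows f 1 T i with nth T i
... | nothing = refl
... | just row = nth-relRow f (suc i) 1 row j

applyAt : (ℕ → ℕ → ℕ → ℕ) → Cell → ℕ
applyAt f q = f (rw q) (cl q) (vl q)

relRow-map : ∀ f r c row → relRow f r c row ≡ map (applyAt f) (rowCells r c row)
relRow-map f r c [] = refl
relRow-map f r c (x ∷ xs) = cong (f r c x ∷_) (relRow-map f r (suc c) xs)

concat-rel : ∀ f r T → concat (relRows f r T) ≡ map (applyAt f) (cellsFrom r T)
concat-rel f r [] = refl
concat-rel f r (row ∷ T) = trans (cong₂ _++_ (relRow-map f r 1 row) (concat-rel f (suc r) T)) (sym (map-++ (applyAt f) (rowCells r 1 row) _))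

vl-rowCells : ∀ r c row → map vl (rowCells r c row) ≡ row
vl-rowCells r c [] = refl
vl-rowCells r c (x ∷ xs) = cong (x ∷_) (vl-rowCells r (suc c) xs)

vl-cells : ∀ r T → map vl (cellsFrom r T) ≡ concat T
vl-cells r [] = refl
vl-cells r (row ∷ T) = trans (map-++ vl (rowCells r 1 row) _) (cong₂ _++_ (vl-rowCells r 1 row) (vl-cells (suc r) T))

∈-rowCells⁻ : ∀ {q} r c row → q ∈ rowCells r c row → (rw q ≡ r) × (Σ[ j ∈ ℕ ] (cl q ≡ c + j) × (nth row j ≡ just (vl q)))
∈-rowCells⁻ r c (x ∷ xs) (here refl) = refl , 0 , sym (+-identityʳ c) , refl
∈-rowCells⁻ r c (x ∷ xs) (there m) with ∈-rowCells⁻ r (suc c) xs m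
... | e , j , e2 , e3 = e , suc j , trans e2 (sym (+-suc c j)) , e3

∈-cellsFrom⁻ : ∀ {q} r T → q ∈ cellsFrom r T → Σ[ i ∈ ℕ ] (rw q ≡ r + i) × (Σ[ j ∈ ℕ ] (cl q ≡ suc j) × (bindM (nth T i) (λ row → nth row j) ≡ just (vl q)))
∈-cellsFrom⁻ r (row ∷ T) m with ∈-++⁻ (rowCells r 1 row) m
... | inj₁ m1 = let (e , j , e2 , e3) = ∈-rowCells⁻ r 1 row m1 in 0 , trans e (sym (+-identityʳ r)) , j , e2 , e3
... | inj₂ m2 = let (i , e , rest) = ∈-cellsFrom⁻ (suc r) T m2 in suc i , trans e (sym (+-suc r i)) , rest

∈-cellsOf⇒cell : ∀ {q} T → q ∈ cellsOf T → cell T (rw q) (cl q) ≡ just (vl q)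
∈-cellsOf⇒cell {q} T m with ∈-cellsFrom⁻ 1 T m
... | i , e , j , e2 , e3 rewrite e | e2 = trans (cell-bind T i j) e3

∈-rowCells⁺ : ∀ r c row j x → nth row j ≡ just x → mkC r (c + j) x ∈ rowCells r c row
∈-rowCells⁺ r c (y ∷ ys) zero x refl rewrite +-identityʳ c = here refl
∈-rowCells⁺ r c (y ∷ ys) (suc j) x e rewrite +-suc c j = there (∈-rowCells⁺ r (suc c) ys j x e)

∈-cellsFrom⁺ : ∀ r T i j x → bindM (nth T i) (λ row → nth row j) ≡ just x → mkC (r + i) (suc j) x ∈ cellsFrom r T
∈-cellsFrom⁺ r (row ∷ T) zero j x e rewrite +-identityʳ r = ∈-++⁺ˡ (∈-rowCells⁺ r 1 row j x e)
∈-cellsFrom⁺ r (row ∷ T) (suc i) j x e rewrite +-suc r i = ∈-++⁺ʳ (rowCells r 1 row) (∈-cellsFrom⁺ (suc r) T i j x e)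

cell⇒∈-cellsOf : ∀ T i j x → cell T i j ≡ just x → mkC i j x ∈ cellsOf T
cell⇒∈-cellsOf T (suc i) (suc j) x e = ∈-cellsFrom⁺ 1 T i j x (trans (sym (cell-bind T i j)) e)

DistinctPos : Cell → Cell → Set
DistinctPos q q2 = (rw q ≡ rw q2) × (cl q ≡ cl q2) → ⊥

rowCells-distinct : ∀ r c row → AllPairs DistinctPos (rowCells r c row)
rowCells-distinct r c [] = []
rowCells-distinct r c (x ∷ xs) = All.tabulate (λ {q} m → let (_ , j , e2 , _) = ∈-rowCells⁻ r (suc c) xs m in λ (_ , ec) → <-irrefl (trans ec e2) (s≤s (m≤m+n c j))) ∷ rowCells-distinct r (suc c) xs

cellsFrom-distinct : ∀ r T → AllPairs DistinctPos (cellsFrom r T)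
cellsFrom-distinct r [] = []
cellsFrom-distinct r (row ∷ T) = AP.++⁺ (rowCells-distinct r 1 row) (cellsFrom-distinct (suc r) T)
  (All.tabulate (λ {q} m1 → All.tabulate (λ {q2} m2 →
    let (e1 , _) = ∈-rowCells⁻ r 1 row m1 in let (i , e2 , _) = ∈-cellsFrom⁻ (suc r) T m2 in
    λ (er , _) → <-irrefl (trans (sym e1) (trans er e2)) (s≤s (m≤m+n r i)))))

posIn-just : ∀ x row p → posIn x row ≡ just p → Σ[ j ∈ ℕ ] (p ≡ suc j) × (nth row j ≡ just x)
posIn-just x (y ∷ ys) p e with x ≡ᵇ y in exy
posIn-just x (y ∷ ys) p refl | true = 0 , refl , cong just (sym (beq⇒≡ x y exy))
... | false with posIn x ys in e2
posIn-just x (y ∷ ys) p refl | false | just p2 = let (j , e3 , e4) = posIn-just x ys p2 e2 in suc j , cong suc e3 , e4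

posIn-nothing : ∀ x row j → posIn x row ≡ nothing → nth row j ≡ just x → ⊥
posIn-nothing x (y ∷ ys) j e e1 with x ≡ᵇ y in exy
posIn-nothing x (y ∷ ys) j () e1 | true
... | false with posIn x ys in e2
posIn-nothing x (y ∷ ys) zero e refl | false | nothing = true≢false (trans (sym (beq-refl x)) exy)
posIn-nothing x (y ∷ ys) (suc j) e e1 | false | nothing = posIn-nothing x ys j e2 e1
posIn-nothing x (y ∷ ys) j () e1 | false | just p

colOf-witness : ∀ r T x q → q ∈ cellsFrom r T → vl q ≡ x → Σ[ q2 ∈ Cell ] (q2 ∈ cellsFrom r T) × (vl q2 ≡ x) × (cl q2 ≡ colOf T x)
colOf-witness r (row ∷ T) x q m ev with posIn x row in e
... | just p = let (j , ep , en) = posIn-just x row p e in mkC r (suc j) x , ∈-++⁺ˡ (∈-rowCells⁺ r 1 row j x en) , refl , sym ep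
... | nothing with ∈-++⁻ (rowCells r 1 row) m
...   | inj₁ m1 = let (_ , j , _ , en) = ∈-rowCells⁻ r 1 row m1 in ⊥-elim (posIn-nothing x row j e (trans en (cong just ev)))
...   | inj₂ m2 = let (q2 , m3 , e3 , e4) = colOf-witness (suc r) T x q m2 ev in q2 , ∈-++⁺ʳ (rowCells r 1 row) m3 , e3 , e4

length-relRow : ∀ f r c row → length (relRow f r c row) ≡ length row
length-relRow f r c [] = refl
length-relRow f r c (x ∷ xs) = cong suc (length-relRow f r (suc c) xs)

relabel-isFilling : ∀ f N N2 r α T → isFillingᵇ N α T ≡ true → All (λ q → inRange1ᵇ N2 (applyAt f q) ≡ true) (cellsFrom r T) → isFillingᵇ N2 α (relRows f r T) ≡ true
relabel-isFilling f N N2 r [] [] _ _ = refl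
relabel-isFilling f N N2 r (a ∷ α) (row ∷ T) v A =
  let (v1 , v2) = ∧-elim {isVecᵇ N a row} v in
  let (l1 , _) = ∧-elim {length row ≡ᵇ a} v1 in
  ∧-intro (∧-intro (subst (λ z → (z ≡ᵇ a) ≡ true) (sym (length-relRow f r 1 row)) l1)
                   (subst (λ z → all (inRange1ᵇ N2) z ≡ true) (sym (relRow-map f r 1 row)) (all-intro (inRange1ᵇ N2) _ (map⁺ (++⁻ˡ (rowCells r 1 row) A)))))
          (relabel-isFilling f N N2 (suc r) α T v2 (++⁻ʳ (rowCells r 1 row) A))
relabel-isFilling f N N2 r [] (_ ∷ _) () _
relabel-isFilling f N N2 r (_ ∷ _) [] () _

isFilling-size : ∀ N α T → isFillingᵇ N α T ≡ true → length (concat T) ≡ sum α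
isFilling-size N [] [] _ = refl
isFilling-size N (a ∷ α) (row ∷ T) v =
  let (v1 , v2) = ∧-elim {isVecᵇ N a row} v in
  let (l1 , _) = ∧-elim {length row ≡ᵇ a} v1 in
  trans (Data.List.Properties.length-++ row) (cong₂ _+_ (beq⇒≡ _ _ l1) (isFilling-size N α T v2))
isFilling-size N [] (_ ∷ _) ()
isFilling-size N (_ ∷ _) [] ()

isFilling-entries : ∀ N r α T → isFillingᵇ N α T ≡ true → All (λ q → inRange1ᵇ N (vl q) ≡ true) (cellsFrom r T)
isFilling-entries N r [] [] _ = []
isFilling-entries N r (a ∷ α) (row ∷ T) v =
  let (v1 , v2) = ∧-elim {isVecᵇ N a row} v in
  let (_ , l2) = ∧-elim {length row ≡ᵇ a} v1 in
  ++⁺ (map⁻ (subst (All (λ x → inRange1ᵇ N x ≡ true)) (sym (vl-rowCells r 1 row)) (all-elim (inRange1ᵇ N) row l2)))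
    (isFilling-entries N (suc r) α T v2)
isFilling-entries N r [] (_ ∷ _) ()
isFilling-entries N r (_ ∷ _) [] ()

length-cells : ∀ r T → length (cellsFrom r T) ≡ length (concat T)
length-cells r T = trans (sym (Data.List.Properties.length-map vl (cellsFrom r T))) (cong length (vl-cells r T))

relabelCell : (ℕ → ℕ → ℕ → ℕ) → Cell → Cell
relabelCell f q = mkC (rw q) (cl q) (applyAt f q)

rowCells-rel : ∀ f r c row → rowCells r c (relRow f r c row) ≡ map (relabelCell f) (rowCells r c row)
rowCells-rel f r c [] = refl
rowCells-rel f r c (x ∷ xs) = cong (mkC r c (f r c x) ∷_) (rowCells-rel f r (suc c) xs)

cells-rel : ∀ f r T → cellsFrom r (relRows f r T) ≡ map (relabelCell f) (cellsFrom r T)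
cells-rel f r [] = refl
cells-rel f r (row ∷ T) = trans (cong₂ _++_ (rowCells-rel f r 1 row) (cells-rel f (suc r) T)) (sym (map-++ (relabelCell f) (rowCells r 1 row) _))

relRow-comp : ∀ f g r c row → relRow f r c (relRow g r c row) ≡ relRow (λ i j x → f i j (g i j x)) r c row
relRow-comp f g r c [] = refl
relRow-comp f g r c (x ∷ xs) = cong (f r c (g r c x) ∷_) (relRow-comp f g r (suc c) xs)

relRows-comp : ∀ f g r T → relRows f r (relRows g r T) ≡ relRows (λ i j x → f i j (g i j x)) r T
relRows-comp f g r [] = refl
relRows-comp f g r (row ∷ T) = cong₂ _∷_ (relRow-comp f g r 1 row) (relRows-comp f g (suc r) T)

relRow-id : ∀ f r c row → All (λ q → applyAt f q ≡ vl q) (rowCells r c row) → relRow f r c row ≡ row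
relRow-id f r c [] _ = refl
relRow-id f r c (x ∷ xs) (e ∷ es) = cong₂ _∷_ e (relRow-id f r (suc c) xs es)

relRows-id : ∀ f r T → All (λ q → applyAt f q ≡ vl q) (cellsFrom r T) → relRows f r T ≡ T
relRows-id f r [] _ = refl
relRows-id f r (row ∷ T) A = cong₂ _∷_ (relRow-id f r 1 row (++⁻ˡ (rowCells r 1 row) A)) (relRows-id f (suc r) T (++⁻ʳ (rowCells r 1 row) A))

-- The standardization order

data Precedes (q p : Cell) : Set where
  by-value : vl q < vl p → Precedes q p
  by-column : vl q ≡ vl p → cl p < cl q → Precedes q p
  by-row-firstColumn : vl q ≡ vl p → cl q ≡ cl p → cl p ≡ 1 → rw q < rw p → Precedes q p
  by-row-otherColumn : vl q ≡ vl p → cl q ≡ cl p → ¬ (cl p ≡ 1) → rw p < rw q → Precedes q p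

precedes? : ∀ q p → Dec (Precedes q p)
precedes? q p with vl q <? vl p
... | yes a = yes (by-value a)
... | no na with vl q ≟ vl p
...   | no ne = no λ { (by-value a) → na a ; (by-column e _) → ne e ; (by-row-firstColumn e _ _ _) → ne e ; (by-row-otherColumn e _ _ _) → ne e }
...   | yes e with cl p <? cl q
...     | yes b = yes (by-column e b)
...     | no nb with cl q ≟ cl p
...       | no nc = no λ { (by-value a) → na a ; (by-column _ b) → nb b ; (by-row-firstColumn _ c _ _) → nc c ; (by-row-otherColumn _ c _ _) → nc c }
...       | yes ec with cl p ≟ 1
...         | yes e1 with rw q <? rw p
...           | yes r = yes (by-row-firstColumn e ec e1 r)
...           | no nr = no λ { (by-value a) → na a ; (by-column _ b) → nb b ; (by-row-firstColumn _ _ _ r) → nr r ; (by-row-otherColumn _ _ n1 _) → n1 e1 }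
precedes? q p | no na | yes e | no nb | yes ec | no n1 with rw p <? rw q
...           | yes r = yes (by-row-otherColumn e ec n1 r)
...           | no nr = no λ { (by-value a) → na a ; (by-column _ b) → nb b ; (by-row-firstColumn _ _ e1 _) → n1 e1 ; (by-row-otherColumn _ _ _ r) → nr r }

precedesᵇ : Cell → Cell → Bool
precedesᵇ q p with precedes? q p
... | yes _ = true
... | no _ = false

precedesᵇ-sound : ∀ q p → precedesᵇ q p ≡ true → Precedes q p
precedesᵇ-sound q p e with precedes? q p
... | yes a = a

precedesᵇ-complete : ∀ q p → Precedes q p → precedesᵇ q p ≡ true
precedesᵇ-complete q p a with precedes? q p
... | yes _ = refl
... | no na = ⊥-elim (na a)

precedesᵇ-false : ∀ q p → ¬ Precedes q p → precedesᵇ q p ≡ false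
precedesᵇ-false q p na with precedes? q p
... | yes a = ⊥-elim (na a)
... | no _ = refl

Precedes-irrefl : ∀ q → ¬ Precedes q q
Precedes-irrefl q (by-value a) = <-irrefl refl a
Precedes-irrefl q (by-column _ b) = <-irrefl refl b
Precedes-irrefl q (by-row-firstColumn _ _ _ r) = <-irrefl refl r
Precedes-irrefl q (by-row-otherColumn _ _ _ r) = <-irrefl refl r

Precedes-value : ∀ {q p} → Precedes q p → vl q ≤ vl p
Precedes-value (by-value a) = <⇒≤ a
Precedes-value (by-column e _) = ≤-reflexive e
Precedes-value (by-row-firstColumn e _ _ _) = ≤-reflexive e
Precedes-value (by-row-otherColumn e _ _ _) = ≤-reflexive e

Precedes-trans : ∀ {a b c} → Precedes a b → Precedes b c → Precedes a c
Precedes-trans (by-value x) h = by-value (<-≤-trans x (Precedes-value h))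
Precedes-trans (by-column e x) (by-value y) = by-value (≤-<-trans (≤-reflexive e) y)
Precedes-trans (by-column e x) (by-column e2 y) = by-column (trans e e2) (<-trans y x)
Precedes-trans (by-column e x) (by-row-firstColumn e2 c2 _ _) = by-column (trans e e2) (≤-trans (s≤s (≤-reflexive (sym c2))) x)
Precedes-trans (by-column e x) (by-row-otherColumn e2 c2 _ _) = by-column (trans e e2) (≤-trans (s≤s (≤-reflexive (sym c2))) x)
Precedes-trans (by-row-firstColumn e c1 _ _) (by-value y) = by-value (≤-<-trans (≤-reflexive e) y)
Precedes-trans (by-row-firstColumn e c1 _ _) (by-column e2 y) = by-column (trans e e2) (≤-trans y (≤-reflexive (sym c1)))
Precedes-trans (by-row-firstColumn e c1 o1 r1) (by-row-firstColumn e2 c2 o2 r2) = by-row-firstColumn (trans e e2) (trans c1 c2) o2 (<-trans r1 r2)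
Precedes-trans (by-row-firstColumn e c1 o1 r1) (by-row-otherColumn e2 c2 n2 r2) = ⊥-elim (n2 (trans (sym c2) o1))
Precedes-trans (by-row-otherColumn e c1 _ _) (by-value y) = by-value (≤-<-trans (≤-reflexive e) y)
Precedes-trans (by-row-otherColumn e c1 _ _) (by-column e2 y) = by-column (trans e e2) (≤-trans y (≤-reflexive (sym c1)))
Precedes-trans (by-row-otherColumn e c1 n1 r1) (by-row-firstColumn e2 c2 o2 r2) = ⊥-elim (n1 (trans c2 o2))
Precedes-trans (by-row-otherColumn e c1 n1 r1) (by-row-otherColumn e2 c2 n2 r2) = by-row-otherColumn (trans e e2) (trans c1 c2) n2 (<-trans r2 r1)

Precedes-total : ∀ a b → DistinctPos a b → ¬ Precedes a b → Precedes b a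
Precedes-total a b dp na with <-cmp (vl a) (vl b)
... | tri< x _ _ = ⊥-elim (na (by-value x))
... | tri> _ _ x = by-value x
... | tri≈ _ ev _ with <-cmp (cl a) (cl b)
...   | tri< x _ _ = by-column (sym ev) x
...   | tri> _ _ x = ⊥-elim (na (by-column ev x))
...   | tri≈ _ ec _ with cl b ≟ 1
...     | yes o with <-cmp (rw a) (rw b)
...       | tri< x _ _ = ⊥-elim (na (by-row-firstColumn ev ec o x))
...       | tri≈ _ er _ = ⊥-elim (dp (er , ec))
...       | tri> _ _ x = by-row-firstColumn (sym ev) (sym ec) (trans ec o) x
Precedes-total a b dp na | tri≈ _ ev _ | tri≈ _ ec _ | no no1 with <-cmp (rw a) (rw b)
...       | tri< x _ _ = by-row-otherColumn (sym ev) (sym ec) (λ o → no1 (trans (sym ec) o)) x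
...       | tri≈ _ er _ = ⊥-elim (dp (er , ec))
...       | tri> _ _ x = ⊥-elim (na (by-row-otherColumn ev ec no1 x))

Precedes-sameValue⇒col-≥ : ∀ {a b} → Precedes a b → vl a ≡ vl b → cl b ≤ cl a
Precedes-sameValue⇒col-≥ (by-value a<b) e = ⊥-elim (<-irrefl e a<b)
Precedes-sameValue⇒col-≥ (by-column _ b<a) _ = <⇒≤ b<a
Precedes-sameValue⇒col-≥ (by-row-firstColumn _ c _ _) _ = ≤-reflexive (sym c)
Precedes-sameValue⇒col-≥ (by-row-otherColumn _ c _ _) _ = ≤-reflexive (sym c)

rank : Filling → Cell → ℕ
rank T p = suc (count (λ q → precedesᵇ q p) (cellsOf T))

rankAt : Filling → ℕ → ℕ → ℕ → ℕ
rankAt T r c x = rank T (mkC r c x)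

standardize : Filling → Filling
standardize T = relabel (rankAt T) T

rank-mono : ∀ T p q → p ∈ cellsOf T → Precedes p q → rank T p < rank T q
rank-mono T p q m pq = s≤s (subst₂ _<_ (sym (countΣ _ (cellsOf T))) (sym (countΣ _ (cellsOf T)))
  (Σ-mono-< (All.tabulate (λ {s} _ → le s)) (lose m lt)))
  where
  le : ∀ s → ⟦ precedesᵇ s p ⟧ ≤ ⟦ precedesᵇ s q ⟧
  le s with precedesᵇ s p in e
  ... | false = z≤n
  ... | true rewrite precedesᵇ-complete s q (Precedes-trans (precedesᵇ-sound s p e) pq) = ≤-refl
  lt : ⟦ precedesᵇ p p ⟧ < ⟦ precedesᵇ p q ⟧
  lt rewrite precedesᵇ-false p p (Precedes-irrefl p) | precedesᵇ-complete p q pq = s≤s z≤n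

rank≤size : ∀ T p → p ∈ cellsOf T → rank T p ≤ length (cellsOf T)
rank≤size T p m = subst₂ _<_ (sym (countΣ _ (cellsOf T))) (Σ-one≡length (cellsOf T))
  (Σ-mono-< (All.tabulate (λ {s} _ → ⟦⟧≤1 (precedesᵇ s p))) (lose m lt))
  where
  lt : ⟦ precedesᵇ p p ⟧ < 1
  lt rewrite precedesᵇ-false p p (Precedes-irrefl p) = s≤s z≤n

cellsOf-samePos : ∀ T p q → p ∈ cellsOf T → q ∈ cellsOf T → rw p ≡ rw q → cl p ≡ cl q → p ≡ q
cellsOf-samePos T (mkC r c x) (mkC r2 c2 y) mp mq refl refl = cong (mkC r c) (just-injective (trans (sym (∈-cellsOf⇒cell T mp)) (∈-cellsOf⇒cell T mq)))

rank-<⇒Precedes : ∀ T p q → p ∈ cellsOf T → q ∈ cellsOf T → rank T p < rank T q → Precedes p q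
rank-<⇒Precedes T p q mp mq lt with precedes? p q
... | yes a = a
... | no na with rw p ≟ rw q | cl p ≟ cl q
...   | yes er | yes ec = ⊥-elim (<-irrefl (cong (rank T) (cellsOf-samePos T p q mp mq er ec)) lt)
...   | no ner | _ = ⊥-elim (<-asym lt (rank-mono T q p mq (Precedes-total p q (λ (er , _) → ner er) na)))
...   | yes _ | no nec = ⊥-elim (<-asym lt (rank-mono T q p mq (Precedes-total p q (λ (_ , ec) → nec ec) na)))

rank-injective : ∀ T p q → p ∈ cellsOf T → q ∈ cellsOf T → DistinctPos p q → rank T p ≡ rank T q → ⊥
rank-injective T p q mp mq dp e with precedes? p q
... | yes a = <-irrefl e (rank-mono T p q mp a)
... | no na = <-irrefl (sym e) (rank-mono T q p mq (Precedes-total p q dp na))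

concat-standardize : ∀ T → concat (standardize T) ≡ map (rank T) (cellsOf T)
concat-standardize T = concat-rel (rankAt T) 1 T

standardize-isPermutation : ∀ T → All (λ t → count (λ x → x ≡ᵇ t) (concat (standardize T)) ≡ 1) (range1 (length (cellsOf T)))
standardize-isPermutation T = all-≤1⇒all≡1 (range1 n) multiplicity
  (All.tabulate (λ {t} _ → subst (_≤ 1) (sym (multiplicity-ranks t)) (count-≤1 (λ q → rank T q ≡ᵇ t) (cellsOf T) (cellsFrom-distinct 1 T) (λ x y mx my px py dp → rank-injective T x y mx my dp (trans (beq⇒≡ (rank T x) t px) (sym (beq⇒≡ (rank T y) t py)))))))
  total
  where
  n = length (cellsOf T)
  multiplicity : ℕ → ℕ
  multiplicity t = count (λ x → x ≡ᵇ t) (concat (standardize T))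
  multiplicity-ranks : ∀ t → multiplicity t ≡ count (λ q → rank T q ≡ᵇ t) (cellsOf T)
  multiplicity-ranks t = trans (cong (count (λ x → x ≡ᵇ t)) (concat-standardize T)) (count-map (λ x → x ≡ᵇ t) (rank T) (cellsOf T))
  total : Σ (range1 n) multiplicity ≡ length (range1 n)
  total =
    begin
      Σ (range1 n) multiplicity
    ≡⟨ Σ-cong (range1 n) (λ t → trans (multiplicity-ranks t) (countΣ _ (cellsOf T))) ⟩
      Σ (range1 n) (λ t → Σ (cellsOf T) (λ q → ⟦ rank T q ≡ᵇ t ⟧))
    ≡⟨ Σ-swap (range1 n) (cellsOf T) (λ t q → ⟦ rank T q ≡ᵇ t ⟧) ⟩
      Σ (cellsOf T) (λ q → Σ (range1 n) (λ t → ⟦ rank T q ≡ᵇ t ⟧))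
    ≡⟨ Σ-cong-local (All.tabulate (λ {q} m → trans (Σ-cong (range1 n) (λ t → cong ⟦_⟧ (beq-sym (rank T q) t))) (trans (Σ-range1-≡ᵇ n (rank T q)) (cong ⟦_⟧ (inIntervalᵇ⁺ (s≤s z≤n) (s≤s (rank≤size T q m))))))) ⟩
      Σ (cellsOf T) (λ q → 1)
    ≡⟨ Σ-one≡length (cellsOf T) ⟩
      n
    ≡⟨ sym (trans (cong length (range1≡interval n)) (length-interval 1 n)) ⟩
      length (range1 n)
    ∎
    where
    open ≡-Reasoning

nth-len : ∀ {A : Set} (xs : List A) j x → nth xs j ≡ just x → j < length xs
nth-len (y ∷ xs) zero x e = s≤s z≤n
nth-len (y ∷ xs) (suc j) x e = s≤s (nth-len xs j x e)

nth-lt : ∀ {A : Set} (xs : List A) j → j < length xs → Σ[ x ∈ A ] nth xs j ≡ just x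
nth-lt (y ∷ xs) zero _ = y , refl
nth-lt (y ∷ xs) (suc j) (s≤s p) = nth-lt xs j p

isFilling-length : ∀ N α T → isFillingᵇ N α T ≡ true → length T ≡ length α
isFilling-length N [] [] _ = refl
isFilling-length N (a ∷ α) (r ∷ T) v = cong suc (isFilling-length N α T (proj₂ (∧-elim {isVecᵇ N a r} v)))
isFilling-length N [] (_ ∷ _) ()
isFilling-length N (_ ∷ _) [] ()

isFilling-rowLength : ∀ N α T i row → isFillingᵇ N α T ≡ true → nth T i ≡ just row → length row ≤ maxPart α
isFilling-rowLength N (a ∷ α) (r ∷ T) zero row v refl =
  ≤-trans (≤-reflexive (beq⇒≡ _ _ (proj₁ (∧-elim {length r ≡ᵇ a} (proj₁ (∧-elim {isVecᵇ N a r} v)))))) (m≤m⊔n a (maxPart α))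
isFilling-rowLength N (a ∷ α) (r ∷ T) (suc i) row v e =
  ≤-trans (isFilling-rowLength N α T i row (proj₂ (∧-elim {isVecᵇ N a r} v)) e) (m≤n⊔m a (maxPart α))

bindM-just : ∀ (m : Maybe (List ℕ)) j x → bindM m (λ row → nth row j) ≡ just x → Σ[ row ∈ List ℕ ] (m ≡ just row) × (nth row j ≡ just x)
bindM-just (just row) j x e = row , refl , e

cell-inShape : ∀ N α T i j x → isFillingᵇ N α T ≡ true → cell T i j ≡ just x → (1 ≤ i) × (i ≤ length α) × (1 ≤ j) × (j ≤ maxPart α)
cell-inShape N α T (suc i) (suc j) x v e with bindM-just (nth T i) j x (trans (sym (cell-bind T i j)) e)
... | row , e1 , e2 = s≤s z≤n , subst (suc i ≤_) (isFilling-length N α T v) (nth-len T i row e1) , s≤s z≤n , ≤-trans (nth-len row j x e2) (isFilling-rowLength N α T i row v e1)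

cell-leftClosed : ∀ T i j x j2 → cell T i j ≡ just x → 1 ≤ j2 → j2 ≤ j → Σ[ y ∈ ℕ ] cell T i j2 ≡ just y
cell-leftClosed T (suc i) (suc j) x (suc j2) e _ (s≤s le) with bindM-just (nth T i) j x (trans (sym (cell-bind T i j)) e)
... | row , e1 , e2 = let (y , ey) = nth-lt row j2 (≤-<-trans le (nth-len row j x e2)) in
  y , trans (cell-bind T i j2) (trans (cong (λ m → bindM m (λ r → nth r j2)) e1) ey)

Cond1 : Filling → Set
Cond1 T = ∀ i j x y → cell T i j ≡ just x → cell T i (suc j) ≡ just y → x < y

strictlyInc-sound : ∀ row j x y → strictlyInc row ≡ true → nth row j ≡ just x → nth row (suc j) ≡ just y → x < y
strictlyInc-sound (a ∷ b ∷ r) zero x y h refl refl = blt⇒< a b (proj₁ (∧-elim {a <ᵇ b} h))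
strictlyInc-sound (a ∷ b ∷ r) (suc j) x y h e1 e2 = strictlyInc-sound (b ∷ r) j x y (proj₂ (∧-elim {a <ᵇ b} h)) e1 e2

strictlyInc-complete : ∀ row → (∀ j x y → nth row j ≡ just x → nth row (suc j) ≡ just y → x < y) → strictlyInc row ≡ true
strictlyInc-complete [] h = refl
strictlyInc-complete (a ∷ []) h = refl
strictlyInc-complete (a ∷ b ∷ r) h = ∧-intro (<⇒blt (h 0 a b refl refl)) (strictlyInc-complete (b ∷ r) (λ j x y → h (suc j) x y))

all-rows-sound : ∀ (p : List ℕ → Bool) T i row → all p T ≡ true → nth T i ≡ just row → p row ≡ true
all-rows-sound p (r ∷ T) zero row h refl = proj₁ (∧-elim {p r} h)
all-rows-sound p (r ∷ T) (suc i) row h e = all-rows-sound p T i row (proj₂ (∧-elim {p r} h)) e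

all-rows-complete : ∀ (p : List ℕ → Bool) T → (∀ i row → nth T i ≡ just row → p row ≡ true) → all p T ≡ true
all-rows-complete p [] h = refl
all-rows-complete p (r ∷ T) h = ∧-intro (h 0 r refl) (all-rows-complete p T (λ i → h (suc i)))

cond1-sound : ∀ T → cond1 T ≡ true → Cond1 T
cond1-sound T h (suc i) (suc j) x y e1 e2 with bindM-just (nth T i) j x (trans (sym (cell-bind T i j)) e1) | bindM-just (nth T i) (suc j) y (trans (sym (cell-bind T i (suc j))) e2)
... | row , r1 , n1 | row2 , r2 , n2 = strictlyInc-sound row j x y (all-rows-sound strictlyInc T i row h r1) n1 (trans (cong (λ z → nth z (suc j)) (just-injective (trans (sym r1) r2))) n2)

cond1-complete : ∀ T → Cond1 T → cond1 T ≡ true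
cond1-complete T h = all-rows-complete strictlyInc T (λ i row er → strictlyInc-complete row (λ j x y n1 n2 →
  h (suc i) (suc j) x y (trans (cell-bind T i j) (trans (cong (λ m → bindM m (λ r → nth r j)) er) n1))
                         (trans (cell-bind T i (suc j)) (trans (cong (λ m → bindM m (λ r → nth r (suc j))) er) n2))))

Cond2 : List ℕ → Filling → Set
Cond2 α T = ∀ i → 1 ≤ i → i < length α → (cell T i 1 ≤∞ cell T (suc i) 1) ≡ true

cond2-sound : ∀ α T → cond2 α T ≡ true → Cond2 α T
cond2-sound α T h i p q = all-range1⁻ _ (length α ∸ 1) h i p (<⇒≤pred q)

cond2-complete : ∀ α T → Cond2 α T → cond2 α T ≡ true
cond2-complete α T h = all-range1⁺ _ (length α ∸ 1) (λ i p q → h i p (≤pred⇒< p q))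

cond3At : Filling → ℕ → ℕ → ℕ → Bool
cond3At T i j k = not (cell T j k <∞ cell T i (suc k)) ∨ (cell T j (suc k) ≤∞ cell T i (suc k))

Cond3 : List ℕ → Filling → Set
Cond3 α T = ∀ i j k → 1 ≤ i → j ≤ length α → i < j → 1 ≤ k → k < maxPart α → cond3At T i j k ≡ true

cond3-sound : ∀ α T → cond3 α T ≡ true → Cond3 α T
cond3-sound α T h i j k i1 jl ij k1 km =
  let hi = all-range1⁻ _ (length α) h i i1 (≤-trans (<⇒≤ ij) jl) in
  let hj = all-range1⁻ _ (length α) hi j (≤-trans (s≤s z≤n) ij) jl in
  all-range1⁻ _ (maxPart α ∸ 1) (implies-elim hj (<⇒blt ij)) k k1 (<⇒≤pred km)

cond3-complete : ∀ α T → Cond3 α T → cond3 α T ≡ true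
cond3-complete α T h =
  all-range1⁺ _ (length α) λ i i1 _ → all-range1⁺ _ (length α) λ j _ jl → implies-intro λ i<ᵇj →
    all-range1⁺ _ (maxPart α ∸ 1) λ k k1 km → h i j k i1 jl (blt⇒< i j i<ᵇj) k1 (≤pred⇒< k1 km)

isSSYRT-sound : ∀ α T → isSSYRT α T ≡ true → Cond1 T × Cond2 α T × Cond3 α T
isSSYRT-sound α T h = let (h1 , h2 , h3) = ∧₃-elim {cond1 T} h in cond1-sound T h1 , cond2-sound α T h2 , cond3-sound α T h3

isSSYRT-complete : ∀ α T → Cond1 T → Cond2 α T → Cond3 α T → isSSYRT α T ≡ true
isSSYRT-complete α T h1 h2 h3 = ∧-intro (cond1-complete T h1) (∧-intro (cond2-complete α T h2) (cond3-complete α T h3))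

count-byValue : ∀ N (p : ℕ → Bool) (L : List ℕ) → All (λ x → inRange1ᵇ N x ≡ true) L →
  count p L ≡ Σ (range1 N) (λ t → ⟦ p t ⟧ * count (λ y → y ≡ᵇ t) L)
count-byValue N p L aL =
  begin
    count p L
  ≡⟨ countΣ p L ⟩
    Σ L (λ x → ⟦ p x ⟧)
  ≡⟨ Σ-cong-local (All.map (λ {x} ix → sym (pt x ix)) aL) ⟩
    Σ L (λ x → Σ (range1 N) (λ t → ⟦ p t ⟧ * ⟦ x ≡ᵇ t ⟧))
  ≡⟨ Σ-swap L (range1 N) (λ x t → ⟦ p t ⟧ * ⟦ x ≡ᵇ t ⟧) ⟩
    Σ (range1 N) (λ t → Σ L (λ x → ⟦ p t ⟧ * ⟦ x ≡ᵇ t ⟧))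
  ≡⟨ Σ-cong (range1 N) (λ t → trans (Σ-*ˡ L ⟦ p t ⟧ (λ x → ⟦ x ≡ᵇ t ⟧)) (cong (⟦ p t ⟧ *_) (sym (countΣ _ L)))) ⟩
    Σ (range1 N) (λ t → ⟦ p t ⟧ * count (λ y → y ≡ᵇ t) L)
  ∎
  where
  open ≡-Reasoning
  pt : ∀ x → inRange1ᵇ N x ≡ true → Σ (range1 N) (λ t → ⟦ p t ⟧ * ⟦ x ≡ᵇ t ⟧) ≡ ⟦ p x ⟧
  pt x ix =
    trans (Σ-cong (range1 N) (λ t → trans (*-comm ⟦ p t ⟧ _) (trans (cong (λ z → ⟦ z ⟧ * ⟦ p t ⟧) (beq-sym x t)) (ind t x))))
    (trans (Σ-*ʳ (range1 N) ⟦ p x ⟧ (λ t → ⟦ t ≡ᵇ x ⟧)) (trans (cong (_* ⟦ p x ⟧) (trans (Σ-range1-≡ᵇ N x) (cong ⟦_⟧ ix))) (+-identityʳ _)))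
    where
    ind : ∀ t x → ⟦ t ≡ᵇ x ⟧ * ⟦ p t ⟧ ≡ ⟦ t ≡ᵇ x ⟧ * ⟦ p x ⟧
    ind t x with t ≡ᵇ x in e
    ... | true rewrite beq⇒≡ t x e = refl
    ... | false = refl

map-≡⇒pointwise : {A B : Set} (f g : A → B) (xs : List A) → map f xs ≡ map g xs → All (λ x → f x ≡ g x) xs
map-≡⇒pointwise f g [] e = []
map-≡⇒pointwise f g (x ∷ xs) e = ∷-injectiveˡ e ∷ map-≡⇒pointwise f g xs (∷-injectiveʳ e)

content-sound : ∀ T v → (content (length v) T ==ᴸ v) ≡ true → All (λ t → count (λ x → x ≡ᵇ t) (concat T) ≡ entry v t) (range1 (length v))
content-sound T v e = map-≡⇒pointwise _ (entry v) (range1 (length v)) (trans (==ᴸ-sound _ v e) (sym (map-entry v)))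

content-complete : ∀ T v → All (λ t → count (λ x → x ≡ᵇ t) (concat T) ≡ entry v t) (range1 (length v)) → (content (length v) T ==ᴸ v) ≡ true
content-complete T v a = subst (λ z → (z ==ᴸ v) ≡ true) (sym (trans (map-cong-local a) (map-entry v))) (==ᴸ-refl v)

Σ-≤ᵇ-entry≡sum-take : ∀ v y → Σ (range1 (length v)) (λ t → ⟦ t ≤ᵇ y ⟧ * entry v t) ≡ sum (take y v)
Σ-≤ᵇ-entry≡sum-take v y = trans (cong (λ z → Σ z (λ t → ⟦ t ≤ᵇ y ⟧ * entry v t)) (range1≡interval (length v))) (on-interval v y)
  where
  drop-first : ∀ a v y → Σ (interval 2 (length v)) (λ t → ⟦ t ≤ᵇ y ⟧ * entry (a ∷ v) t) ≡ Σ (interval 1 (length v)) (λ t → ⟦ suc t ≤ᵇ y ⟧ * entry v t)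
  drop-first a v y = trans (cong (λ z → Σ z (λ t → ⟦ t ≤ᵇ y ⟧ * entry (a ∷ v) t)) (interval-suc 1 (length v)))
    (trans (Σ-map suc (interval 1 (length v)) _) (Σ-cong-local (All.map (λ {t} p → shift-entry t p) (interval-lowerBound 1 (length v)))))
    where
    shift-entry : ∀ t → 1 ≤ t → ⟦ suc t ≤ᵇ y ⟧ * entry (a ∷ v) (suc t) ≡ ⟦ suc t ≤ᵇ y ⟧ * entry v t
    shift-entry (suc t) _ = refl
  on-interval : ∀ v y → Σ (interval 1 (length v)) (λ t → ⟦ t ≤ᵇ y ⟧ * entry v t) ≡ sum (take y v)
  on-interval [] zero = refl
  on-interval [] (suc y) = refl
  on-interval (a ∷ v) zero = trans (drop-first a v 0) (Σ-0 (interval 1 (length v)))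
  on-interval (a ∷ v) (suc y) = cong₂ _+_ (+-identityʳ a) (trans (drop-first a v (suc y)) (trans (Σ-cong (interval 1 (length v)) (λ t → cong (λ z → ⟦ z ⟧ * entry v t) (suc-≤ᵇ-suc t y))) (on-interval v y)))

-- Destandardization

blockAt : List ℕ → ℕ → ℕ → ℕ → ℕ
blockAt v i j x = block v x

destandardize : List ℕ → Filling → Filling
destandardize v σ = relabel (blockAt v) σ

cond3-values : ∀ {a b c} (A B C : Maybe ℕ) → A ≡ just a → B ≡ just b → C ≡ just c → a < b →
  (not (A <∞ B) ∨ (C ≤∞ B)) ≡ true → c ≤ b
cond3-values {a} {b} {c} (just a) (just b) (just c) refl refl refl a<b h = ble⇒≤ c b (implies-elim h (<⇒blt a<b))

map-mono-≤∞ : ∀ (f : ℕ → ℕ) → (∀ {a b} → a ≤ b → f a ≤ f b) → ∀ x y → (x ≤∞ y) ≡ true → (Maybe.map f x ≤∞ Maybe.map f y) ≡ true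
map-mono-≤∞ f mono (just a) (just b) h = ≤⇒ble (mono (ble⇒≤ a b h))
map-mono-≤∞ f mono (just a) nothing h = refl
map-mono-≤∞ f mono nothing nothing h = refl

map-reflects-<∞ : ∀ (f : ℕ → ℕ) → (∀ {a b} → a ≤ b → f a ≤ f b) → ∀ x y → (Maybe.map f x <∞ Maybe.map f y) ≡ true → (x <∞ y) ≡ true
map-reflects-<∞ f mono (just a) (just b) h with a <? b
... | yes p = <⇒blt p
... | no p = ⊥-elim (<-irrefl refl (<-≤-trans (blt⇒< (f a) (f b) h) (mono (≮⇒≥ p))))
map-reflects-<∞ f mono (just a) nothing h = refl

≤∞-nothing : ∀ m → (m ≤∞ nothing) ≡ true
≤∞-nothing (just a) = refl
≤∞-nothing nothing = refl

map≡just⁻ : ∀ (f : ℕ → ℕ) m a → Maybe.map f m ≡ just a → Σ[ x ∈ ℕ ] (m ≡ just x) × (f x ≡ a)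
map≡just⁻ f (just x) a e = x , refl , just-injective e

∞≰just : ∀ (m : Maybe ℕ) y → m ≡ just y → (nothing ≤∞ m) ≡ true → ⊥
∞≰just (just a) y refl ()

≤∞-just⇒≤ : ∀ z (m : Maybe ℕ) y → m ≡ just y → (just z ≤∞ m) ≡ true → z ≤ y
≤∞-just⇒≤ z (just a) y refl h = ble⇒≤ z a h

module Destandardize (α v : List ℕ) (σ : Filling)
  (n≡ : sum v ≡ sum α)
  (valid : isFillingᵇ (sum α) α σ ≡ true)
  (c1 : Cond1 σ) (c2 : Cond2 α σ) (c3 : Cond3 α σ)
  (perm : All (λ t → count (λ x → x ≡ᵇ t) (concat σ) ≡ 1) (range1 (sum α)))
  (descents-compatible : ∀ i → 1 ≤ i → i < sum α → colOf σ i < colOf σ (suc i) → block v i < block v (suc i))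
  where

  n : ℕ
  n = sum α
  cs : List Cell
  cs = cellsOf σ

  entries-inRange : All (λ q → inRange1ᵇ n (vl q) ≡ true) cs
  entries-inRange = isFilling-entries n 1 α σ valid

  entry-bounds : ∀ {q} → q ∈ cs → (1 ≤ vl q) × (vl q ≤ n)
  entry-bounds {q} m = let (a , b) = inIntervalᵇ⁻ 1 n (vl q) (All.lookup entries-inRange m) in a , ≤-pred b

  cell-at : ∀ {q} → q ∈ cs → cell σ (rw q) (cl q) ≡ just (vl q)
  cell-at = ∈-cellsOf⇒cell σ

  inShape : ∀ {q} → q ∈ cs → (1 ≤ rw q) × (rw q ≤ length α) × (1 ≤ cl q) × (cl q ≤ maxPart α)
  inShape {q} m = cell-inShape n α σ (rw q) (cl q) (vl q) valid (cell-at m)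

  count-value-cells : ∀ ℓ → count (λ q → vl q ≡ᵇ ℓ) cs ≡ count (λ x → x ≡ᵇ ℓ) (concat σ)
  count-value-cells ℓ = trans (sym (count-map (λ x → x ≡ᵇ ℓ) vl cs)) (cong (count (λ x → x ≡ᵇ ℓ)) (vl-cells 1 σ))

  count-value≡1 : ∀ ℓ → 1 ≤ ℓ → ℓ ≤ n → count (λ q → vl q ≡ᵇ ℓ) cs ≡ 1
  count-value≡1 ℓ p q = trans (count-value-cells ℓ) (All.lookup perm (∈-range1⁺ n ℓ p q))

  distinct-values : ∀ p q → p ∈ cs → q ∈ cs → p ≢ q → vl p ≢ vl q
  distinct-values p q mp mq p≢q e =
    let (a , b) = entry-bounds mp in
    <-irrefl refl (≤-trans (count-two (λ s → vl s ≡ᵇ vl p) cs p q mp mq p≢q (beq-refl (vl p)) (subst (λ z → (z ≡ᵇ vl p) ≡ true) e (beq-refl (vl p))))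
                           (≤-reflexive (count-value≡1 (vl p) a b)))

  value-injective : ∀ p q → p ∈ cs → q ∈ cs → vl p ≡ vl q → p ≡ q
  value-injective p q mp mq e with rw p ≟ rw q | cl p ≟ cl q
  ... | yes er | yes ec = cellsOf-samePos σ p q mp mq er ec
  ... | no ner | _ = ⊥-elim (distinct-values p q mp mq (ner ∘ cong rw) e)
  ... | yes _ | no nec = ⊥-elim (distinct-values p q mp mq (nec ∘ cong cl) e)

  colOf-value : ∀ q → q ∈ cs → colOf σ (vl q) ≡ cl q
  colOf-value q m = let (q2 , m2 , e2 , e3) = colOf-witness 1 σ (vl q) q m refl in trans (sym e3) (cong cl (value-injective q2 q m2 m e2))

  colOf-antitone-in-block : ∀ ℓ d → 1 ≤ ℓ → ℓ + d ≤ n → block v ℓ ≡ block v (ℓ + d) → colOf σ (ℓ + d) ≤ colOf σ ℓ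
  colOf-antitone-in-block ℓ zero _ _ _ rewrite +-identityʳ ℓ = ≤-refl
  colOf-antitone-in-block ℓ (suc d) p q e =
    subst (λ z → colOf σ z ≤ colOf σ ℓ) (sym (+-suc ℓ d)) (≤-trans step IH)
    where
    i<n : ℓ + d < n
    i<n = ≤-trans (≤-reflexive (sym (+-suc ℓ d))) q
    sameBlock : block v ℓ ≡ block v (ℓ + d)
    sameBlock = ≤-antisym (block-mono v (m≤m+n ℓ d)) (≤-trans (block-mono v (n≤1+n (ℓ + d))) (≤-reflexive (sym (trans e (cong (block v) (+-suc ℓ d))))))
    IH : colOf σ (ℓ + d) ≤ colOf σ ℓ
    IH = colOf-antitone-in-block ℓ d p (<⇒≤ i<n) sameBlock
    step : colOf σ (suc (ℓ + d)) ≤ colOf σ (ℓ + d)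
    step with colOf σ (ℓ + d) <? colOf σ (suc (ℓ + d))
    ... | no np = ≮⇒≥ np
    ... | yes lt = ⊥-elim (<-irrefl (trans (sym sameBlock) (trans e (cong (block v) (+-suc ℓ d))))
                                     (descents-compatible (ℓ + d) (≤-trans p (m≤m+n ℓ d)) i<n lt))

  col-antitone-in-block : ∀ s q → s ∈ cs → q ∈ cs → vl s < vl q → block v (vl s) ≡ block v (vl q) → cl q ≤ cl s
  col-antitone-in-block s q ms mq lt e =
    subst₂ _≤_ (colOf-value q mq) (colOf-value s ms)
      (subst (λ z → colOf σ z ≤ colOf σ (vl s)) eq (colOf-antitone-in-block (vl s) (vl q ∸ vl s) (proj₁ (entry-bounds ms)) (≤-trans (≤-reflexive eq) (proj₂ (entry-bounds mq))) (trans e (cong (block v) (sym eq)))))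
    where
    eq : vl s + (vl q ∸ vl s) ≡ vl q
    eq = m+[n∸m]≡n (<⇒≤ lt)

  firstColumn-ascending : ∀ r d x y → 1 ≤ r → r + d ≤ length α → cell σ r 1 ≡ just x → cell σ (r + d) 1 ≡ just y → x ≤ y
  firstColumn-ascending r zero x y _ _ e1 e2 rewrite +-identityʳ r = ≤-reflexive (just-injective (trans (sym e1) e2))
  firstColumn-ascending r (suc d) x y p q e1 e2 with cell σ (r + d) 1 in ez | c2 (r + d) (≤-trans p (m≤m+n r d)) (≤-trans (≤-reflexive (sym (+-suc r d))) q)
  ... | nothing | h = ⊥-elim (∞≰just (cell σ (suc (r + d)) 1) y e2' h)
    where
    e2' : cell σ (suc (r + d)) 1 ≡ just y
    e2' = trans (cong (λ z → cell σ z 1) (sym (+-suc r d))) e2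
  ... | just z | h = ≤-trans (firstColumn-ascending r d x z p (≤-trans (n≤1+n (r + d)) (≤-trans (≤-reflexive (sym (+-suc r d))) q)) e1 ez) (≤∞-just⇒≤ z (cell σ (suc (r + d)) 1) y e2' h)
    where
    e2' : cell σ (suc (r + d)) 1 ≡ just y
    e2' = trans (cong (λ z → cell σ z 1) (sym (+-suc r d))) e2

  firstColumn-rowOrder : ∀ s q → s ∈ cs → q ∈ cs → vl s < vl q → cl s ≡ cl q → cl q ≡ 1 → ¬ (rw q < rw s)
  firstColumn-rowOrder s q ms mq lt ecl o q<s =
    <⇒≱ lt (firstColumn-ascending (rw q) (rw s ∸ rw q) (vl q) (vl s) (proj₁ (inShape mq))
             (≤-trans (≤-reflexive (m+[n∸m]≡n (<⇒≤ q<s))) (proj₁ (proj₂ (inShape ms))))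
             (trans (cong (cell σ (rw q)) (sym o)) (cell-at mq))
             (trans (cong₂ (cell σ) (m+[n∸m]≡n (<⇒≤ q<s)) (sym (trans ecl o))) (cell-at ms)))

  -- Let w be the entry just left of q. It lies in an earlier block than q (within a block columns weakly
  -- decrease), hence w < vl s, and condition (3) for the rows of s and q then forces vl q ≤ vl s.
  sameBlock-otherColumn-rowOrder : ∀ s q → s ∈ cs → q ∈ cs → vl s < vl q → block v (vl s) ≡ block v (vl q) →
    cl s ≡ cl q → ∀ k → cl q ≡ suc k → 1 ≤ k → ¬ (rw s < rw q)
  sameBlock-otherColumn-rowOrder s q ms mq lt eqb ecl k e k≥1 s<q = absurd
    where
    left : Σ[ w ∈ ℕ ] cell σ (rw q) k ≡ just w
    left = cell-leftClosed σ (rw q) (cl q) (vl q) k (cell-at mq) k≥1 (≤-trans (n≤1+n k) (≤-reflexive (sym e)))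
    w : ℕ
    w = proj₁ left
    w<q : w < vl q
    w<q = c1 (rw q) k w (vl q) (proj₂ left) (trans (cong (cell σ (rw q)) (sym e)) (cell-at mq))
    w∈cs : mkC (rw q) k w ∈ cs
    w∈cs = cell⇒∈-cellsOf σ (rw q) k w (proj₂ left)
    w<s : block v w < block v (vl q) → w < vl s
    w<s bw = ≰⇒> λ s≤w → <-irrefl refl (<-≤-trans bw (≤-trans (≤-reflexive (sym eqb)) (block-mono v s≤w)))
    absurd : ⊥
    absurd with block v w <? block v (vl q)
    ... | no nb = <-irrefl refl (≤-trans (≤-reflexive (sym e)) (col-antitone-in-block (mkC (rw q) k w) q w∈cs mq w<q (block-≮⇒≡ v (<⇒≤ w<q) nb)))
    ... | yes bw = <⇒≱ lt (cond3-values (cell σ (rw q) k) (cell σ (rw s) (suc k)) (cell σ (rw q) (suc k))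
                     (proj₂ left) (trans (cong (cell σ (rw s)) (sym (trans ecl e))) (cell-at ms)) (trans (cong (cell σ (rw q)) (sym e)) (cell-at mq))
                     (w<s bw) (c3 (rw s) (rw q) k (proj₁ (inShape ms)) (proj₁ (proj₂ (inShape mq))) s<q k≥1 (≤-trans (≤-reflexive (sym e)) (proj₂ (proj₂ (proj₂ (inShape mq)))))))

  destdCell : Cell → Cell
  destdCell = relabelCell (blockAt v)

  sameColumn-Precedes : ∀ s q → s ∈ cs → q ∈ cs → vl s < vl q → block v (vl s) ≡ block v (vl q) → cl s ≡ cl q →
    Precedes (destdCell s) (destdCell q)
  sameColumn-Precedes s q ms mq lt eqb ecl with cl q ≟ 1 | <-cmp (rw s) (rw q)
  ... | _ | tri≈ _ er _ = ⊥-elim (<-irrefl (cong vl (cellsOf-samePos σ s q ms mq er ecl)) lt)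
  ... | yes o | tri< r _ _ = by-row-firstColumn eqb ecl o r
  ... | yes o | tri> _ _ r = ⊥-elim (firstColumn-rowOrder s q ms mq lt ecl o r)
  ... | no o | tri> _ _ r = by-row-otherColumn eqb ecl o r
  ... | no o | tri< r _ _ with cl q in e | proj₁ (proj₂ (proj₂ (inShape mq)))
  ...   | zero | ()
  ...   | suc zero | _ = ⊥-elim (o refl)
  ...   | suc (suc k) | _ = ⊥-elim (sameBlock-otherColumn-rowOrder s q ms mq lt eqb (trans ecl (sym e)) (suc k) e (s≤s z≤n) r)

  destandardize-Precedes : ∀ s q → s ∈ cs → q ∈ cs → vl s < vl q → Precedes (destdCell s) (destdCell q)
  destandardize-Precedes s q ms mq lt with block v (vl s) <? block v (vl q)
  ... | yes b< = by-value b<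
  ... | no b≮ with cl q <? cl s
  ...   | yes c< = by-column (block-≮⇒≡ v (<⇒≤ lt) b≮) c<
  ...   | no c≮ = sameColumn-Precedes s q ms mq lt sameBlock (≤-antisym (≮⇒≥ c≮) (col-antitone-in-block s q ms mq lt sameBlock))
    where
    sameBlock : block v (vl s) ≡ block v (vl q)
    sameBlock = block-≮⇒≡ v (<⇒≤ lt) b≮

  precedesᵇ-destdCell : ∀ s q → s ∈ cs → q ∈ cs → precedesᵇ (destdCell s) (destdCell q) ≡ (vl s <ᵇ vl q)
  precedesᵇ-destdCell s q ms mq with <-cmp (vl s) (vl q)
  ... | tri< x _ _ = trans (precedesᵇ-complete _ _ (destandardize-Precedes s q ms mq x)) (sym (<⇒blt x))
  ... | tri≈ _ e _ rewrite value-injective s q ms mq e = trans (precedesᵇ-false _ _ (Precedes-irrefl (destdCell q))) (sym (≥⇒bltF {vl q} {vl q} ≤-refl))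
  ... | tri> _ _ x = trans (precedesᵇ-false _ _ (λ h → Precedes-irrefl _ (Precedes-trans h (destandardize-Precedes q s mq ms x)))) (sym (≥⇒bltF (<⇒≤ x)))

  rank-destandardize : ∀ q → q ∈ cs → rank (destandardize v σ) (destdCell q) ≡ vl q
  rank-destandardize q mq =
    begin
      suc (count (λ s → precedesᵇ s (destdCell q)) (cellsOf (destandardize v σ)))
    ≡⟨ cong (λ L → suc (count (λ s → precedesᵇ s (destdCell q)) L)) (cells-rel (blockAt v) 1 σ) ⟩
      suc (count (λ s → precedesᵇ s (destdCell q)) (map destdCell cs))
    ≡⟨ cong suc (count-map _ destdCell cs) ⟩
      suc (count (λ s → precedesᵇ (destdCell s) (destdCell q)) cs)
    ≡⟨ cong suc (trans (countΣ _ cs) (trans (Σ-cong-local (All.tabulate (λ {s} ms → cong ⟦_⟧ (precedesᵇ-destdCell s q ms mq)))) (sym (countΣ _ cs)))) ⟩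
      suc (count (λ s → vl s <ᵇ vl q) cs)
    ≡⟨ cong suc (trans (sym (count-map (λ x → x <ᵇ vl q) vl cs)) (cong (count (λ x → x <ᵇ vl q)) (vl-cells 1 σ))) ⟩
      suc (count (λ x → x <ᵇ vl q) (concat σ))
    ≡⟨ cong suc (count-byValue n (λ x → x <ᵇ vl q) (concat σ) (subst (All (λ x → inRange1ᵇ n x ≡ true)) (vl-cells 1 σ) (map⁺ entries-inRange))) ⟩
      suc (Σ (range1 n) (λ t → ⟦ t <ᵇ vl q ⟧ * count (λ y → y ≡ᵇ t) (concat σ)))
    ≡⟨ cong suc (trans (Σ-cong-local (All.map (λ {t} e → trans (cong (⟦ t <ᵇ vl q ⟧ *_) e) (*-identityʳ ⟦ t <ᵇ vl q ⟧)) perm)) (Σ-range1-<ᵇ n (vl q) (proj₁ (entry-bounds mq)) (proj₂ (entry-bounds mq)))) ⟩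
      suc (vl q ∸ 1)
    ≡⟨ trans (+-comm 1 (vl q ∸ 1)) (m∸n+n≡m (proj₁ (entry-bounds mq))) ⟩
      vl q
    ∎
    where
    open ≡-Reasoning

  standardize∘destandardize : standardize (destandardize v σ) ≡ σ
  standardize∘destandardize = trans (relRows-comp (rankAt (destandardize v σ)) (blockAt v) 1 σ)
    (relRows-id _ 1 σ (All.tabulate (λ {q} mq → rank-destandardize q mq)))

  cell-destandardize : ∀ i j → cell (destandardize v σ) i j ≡ Maybe.map (block v) (cell σ i j)
  cell-destandardize i j = cell-rel (blockAt v) σ i j

  destd-cond1 : Cond1 (destandardize v σ)
  destd-cond1 i j a b e1 e2 with cell σ i j in x1 | cell σ i (suc j) in x2
  ... | just x | just y = subst₂ _<_ (just-injective (trans (sym (cong (Maybe.map (block v)) x1)) (trans (sym (cell-destandardize i j)) e1))) (just-injective (trans (sym (cong (Maybe.map (block v)) x2)) (trans (sym (cell-destandardize i (suc j))) e2))) lt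
    where
    xy : x < y
    xy = c1 i j x y x1 x2
    lt : block v x < block v y
    lt with block v x <? block v y
    ... | yes p = p
    ... | no np = ⊥-elim (<-irrefl refl (col-antitone-in-block (mkC i j x) (mkC i (suc j) y) (cell⇒∈-cellsOf σ i j x x1) (cell⇒∈-cellsOf σ i (suc j) y x2) xy (block-≮⇒≡ v (<⇒≤ xy) np)))
  ... | nothing | _ = ⊥-elim (nothing≢just (trans (sym (trans (cell-destandardize i j) (cong (Maybe.map (block v)) x1))) e1))
  ... | just x | nothing = ⊥-elim (nothing≢just (trans (sym (trans (cell-destandardize i (suc j)) (cong (Maybe.map (block v)) x2))) e2))

  destd-cond2 : Cond2 α (destandardize v σ)
  destd-cond2 i p q rewrite cell-destandardize i 1 | cell-destandardize (suc i) 1 = map-mono-≤∞ (block v) (block-mono v) (cell σ i 1) (cell σ (suc i) 1) (c2 i p q)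

  destd-cond3 : Cond3 α (destandardize v σ)
  destd-cond3 i j k a b c d e rewrite cell-destandardize j k | cell-destandardize i (suc k) | cell-destandardize j (suc k) = i3m (cell σ j k) (cell σ i (suc k)) (cell σ j (suc k)) (c3 i j k a b c d e)
    where
    i3m : ∀ A B Cc → (not (A <∞ B) ∨ (Cc ≤∞ B)) ≡ true → (not (Maybe.map (block v) A <∞ Maybe.map (block v) B) ∨ (Maybe.map (block v) Cc ≤∞ Maybe.map (block v) B)) ≡ true
    i3m A B Cc h with Maybe.map (block v) A <∞ Maybe.map (block v) B in e1
    ... | false = refl
    ... | true with A <∞ B | map-reflects-<∞ (block v) (block-mono v) A B e1
    ...   | true | _ = map-mono-≤∞ (block v) (block-mono v) Cc B h

  concat-destandardize : concat (destandardize v σ) ≡ map (block v) (concat σ)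
  concat-destandardize = trans (concat-rel (blockAt v) 1 σ) (trans (Data.List.Properties.map-∘ {g = block v} {f = vl} cs) (cong (map (block v)) (vl-cells 1 σ)))

  destd-content : (content (length v) (destandardize v σ) ==ᴸ v) ≡ true
  destd-content = content-complete (destandardize v σ) v (All.tabulate (λ {t} mt → pt t (proj₁ (∈-range1⁻ (length v) t mt))))
    where
    pt : ∀ t → 1 ≤ t → count (λ x → x ≡ᵇ t) (concat (destandardize v σ)) ≡ entry v t
    pt t p =
      trans (cong (count (λ x → x ≡ᵇ t)) concat-destandardize)
      (trans (count-map (λ x → x ≡ᵇ t) (block v) (concat σ))
      (trans (count-byValue n (λ x → block v x ≡ᵇ t) (concat σ) (subst (All (λ x → inRange1ᵇ n x ≡ true)) (vl-cells 1 σ) (map⁺ entries-inRange)))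
      (trans (Σ-cong-local (All.map (λ {ℓ} e → trans (cong (⟦ block v ℓ ≡ᵇ t ⟧ *_) e) (*-identityʳ ⟦ block v ℓ ≡ᵇ t ⟧)) perm))
      (trans (cong (λ z → Σ (range1 z) (λ ℓ → ⟦ block v ℓ ≡ᵇ t ⟧)) (sym n≡)) (block-fibre v t p)))))

  destd-isFilling : isFillingᵇ (length v) α (destandardize v σ) ≡ true
  destd-isFilling = relabel-isFilling (blockAt v) n (length v) 1 α σ valid (All.tabulate (λ {q} mq →
    inIntervalᵇ⁺ (block-positive v (vl q)) (s≤s (block-bound v (vl q) (proj₁ (entry-bounds mq)) (≤-trans (proj₂ (entry-bounds mq)) (≤-reflexive (sym n≡)))))))


-- Standardization

module Standardize (α v : List ℕ) (T : Filling)
  (valid : isFillingᵇ (length v) α T ≡ true)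
  (c1 : Cond1 T) (c2 : Cond2 α T) (c3 : Cond3 α T)
  (cnt : All (λ t → count (λ x → x ≡ᵇ t) (concat T) ≡ entry v t) (range1 (length v)))
  where

  N : ℕ
  N = length v
  n : ℕ
  n = sum α
  cs : List Cell
  cs = cellsOf T
  σ : Filling
  σ = standardize T

  length-cells-of : length cs ≡ n
  length-cells-of = trans (length-cells 1 T) (isFilling-size N α T valid)

  entries-inRange : All (λ q → inRange1ᵇ N (vl q) ≡ true) cs
  entries-inRange = isFilling-entries N 1 α T valid

  entry-bounds : ∀ {q} → q ∈ cs → (1 ≤ vl q) × (vl q ≤ N)
  entry-bounds {q} m = let (a , b) = inIntervalᵇ⁻ 1 N (vl q) (All.lookup entries-inRange m) in a , ≤-pred b

  entries-inRange-concat : All (λ x → inRange1ᵇ N x ≡ true) (concat T)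
  entries-inRange-concat = subst (All (λ x → inRange1ᵇ N x ≡ true)) (vl-cells 1 T) (map⁺ entries-inRange)

  count-cells-byValue : ∀ (p : ℕ → Bool) → count (λ q → p (vl q)) cs ≡ count p (concat T)
  count-cells-byValue p = trans (sym (count-map p vl cs)) (cong (count p) (vl-cells 1 T))

  sum-weight : sum v ≡ n
  sum-weight = trans (sym (trans (count-byValue N (λ _ → true) (concat T) entries-inRange-concat) (trans (Σ-cong-local (All.map (λ {t} e → trans (+-identityʳ _) e) cnt)) (cong sum (map-entry v)))))
    (trans (trans (countΣ _ (concat T)) (Σ-one≡length (concat T))) (isFilling-size N α T valid))

  count-value-< : ∀ x → 1 ≤ x → count (λ q → vl q <ᵇ x) cs ≡ sum (take (x ∸ 1) v)
  count-value-< (suc y) _ = trans (count-cells-byValue (λ z → z <ᵇ suc y)) (trans (count-byValue N _ (concat T) entries-inRange-concat)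
    (trans (Σ-cong-local (All.map (λ {t} e → cong₂ _*_ (cong ⟦_⟧ (<ᵇ-suc≡≤ᵇ t y)) e) cnt)) (Σ-≤ᵇ-entry≡sum-take v y)))

  count-value-≤ : ∀ x → count (λ q → vl q ≤ᵇ x) cs ≡ sum (take x v)
  count-value-≤ x = trans (count-cells-byValue (λ z → z ≤ᵇ x)) (trans (count-byValue N _ (concat T) entries-inRange-concat)
    (trans (Σ-cong-local (All.map (λ {t} e → cong (⟦ t ≤ᵇ x ⟧ *_) e) cnt)) (Σ-≤ᵇ-entry≡sum-take v x)))

  -- Every cell with a smaller entry precedes q and every cell preceding q has an entry ≤ vl q, so
  -- v₁ + ⋯ + v₍ₓ₋₁₎ < rank T q ≤ v₁ + ⋯ + vₓ for x = vl q.
  block∘rank : ∀ q → q ∈ cs → block v (rank T q) ≡ vl q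
  block∘rank q mq = trans (block-between-partialSums v (x ∸ 1) (rank T q) yl lo hi) (trans (+-comm 1 (x ∸ 1)) (m∸n+n≡m x1))
    where
    x : ℕ
    x = vl q
    x1 : 1 ≤ x
    x1 = proj₁ (entry-bounds mq)
    yl : x ∸ 1 < length v
    yl = ≤-trans (≤-reflexive (trans (+-comm 1 (x ∸ 1)) (m∸n+n≡m x1))) (proj₂ (entry-bounds mq))
    below-precede : count (λ q2 → vl q2 <ᵇ x) cs ≤ count (λ q2 → precedesᵇ q2 q) cs
    below-precede = subst₂ _≤_ (sym (countΣ _ cs)) (sym (countΣ _ cs)) (Σ-mono-≤ {xs = cs} (All.tabulate (λ {s} _ → f s)))
      where
      f : ∀ s → ⟦ vl s <ᵇ x ⟧ ≤ ⟦ precedesᵇ s q ⟧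
      f s = ⟦⟧-mono _ _ (λ e → precedesᵇ-complete s q (by-value (blt⇒< (vl s) x e)))
    precede-below : count (λ q2 → precedesᵇ q2 q) cs < count (λ q2 → vl q2 ≤ᵇ x) cs
    precede-below = subst₂ _<_ (sym (countΣ _ cs)) (sym (countΣ _ cs)) (Σ-mono-< {xs = cs} (All.tabulate (λ {s} _ → f s)) (lose mq g))
      where
      f : ∀ s → ⟦ precedesᵇ s q ⟧ ≤ ⟦ vl s ≤ᵇ x ⟧
      f s = ⟦⟧-mono _ _ (λ e → ≤⇒ble (Precedes-value (precedesᵇ-sound s q e)))
      g : ⟦ precedesᵇ q q ⟧ < ⟦ vl q ≤ᵇ x ⟧
      g rewrite precedesᵇ-false q q (Precedes-irrefl q) | ≤⇒ble (≤-refl {x}) = s≤s z≤n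
    lo : sum (take (x ∸ 1) v) < rank T q
    lo = s≤s (subst (_≤ count (λ q2 → precedesᵇ q2 q) cs) (count-value-< x x1) below-precede)
    hi : rank T q ≤ sum (take (suc (x ∸ 1)) v)
    hi = subst (rank T q ≤_) (trans (count-value-≤ x) (cong (λ z → sum (take z v)) (sym (trans (+-comm 1 (x ∸ 1)) (m∸n+n≡m x1))))) precede-below

  destandardize∘standardize : destandardize v σ ≡ T
  destandardize∘standardize = trans (relRows-comp (blockAt v) (rankAt T) 1 T) (relRows-id _ 1 T (All.tabulate (λ {q} mq → block∘rank q mq)))

  rank-inRange : ∀ q → q ∈ cs → inRange1ᵇ n (rank T q) ≡ true
  rank-inRange q mq = inIntervalᵇ⁺ (s≤s z≤n) (s≤s (≤-trans (rank≤size T q mq) (≤-reflexive length-cells-of)))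

  std-isFilling : isFillingᵇ n α σ ≡ true
  std-isFilling = relabel-isFilling (rankAt T) N n 1 α T valid (All.tabulate (λ {q} mq → rank-inRange q mq))

  std-isPermutation : All (λ t → count (λ x → x ≡ᵇ t) (concat σ) ≡ 1) (range1 n)
  std-isPermutation = subst (λ z → All (λ t → count (λ x → x ≡ᵇ t) (concat σ) ≡ 1) (range1 z)) length-cells-of (standardize-isPermutation T)

  cell-standardize : ∀ i j → cell σ i j ≡ Maybe.map (rankAt T i j) (cell T i j)
  cell-standardize i j = cell-rel (rankAt T) T i j

  std-cond1 : Cond1 σ
  std-cond1 i j a b e1 e2 =
    let (x , x1 , fx) = map≡just⁻ (rankAt T i j) (cell T i j) a (trans (sym (cell-standardize i j)) e1) in
    let (y , y1 , fy) = map≡just⁻ (rankAt T i (suc j)) (cell T i (suc j)) b (trans (sym (cell-standardize i (suc j))) e2) in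
    subst₂ _<_ fx fy (rank-mono T (mkC i j x) (mkC i (suc j) y) (cell⇒∈-cellsOf T i j x x1) (by-value (c1 i j x y x1 y1)))

  std-cond2 : Cond2 α σ
  std-cond2 i p q rewrite cell-standardize i 1 | cell-standardize (suc i) 1 = ranks-ascend (cell T i 1) (cell T (suc i) 1) refl refl (c2 i p q)
    where
    ranks-ascend : ∀ A B → cell T i 1 ≡ A → cell T (suc i) 1 ≡ B → (A ≤∞ B) ≡ true → (Maybe.map (rankAt T i 1) A ≤∞ Maybe.map (rankAt T (suc i) 1) B) ≡ true
    ranks-ascend (just x) (just y) eA eB h = ≤⇒ble (<⇒≤ (rank-mono T (mkC i 1 x) (mkC (suc i) 1 y) (cell⇒∈-cellsOf T i 1 x eA) ordered))
      where
      ordered : Precedes (mkC i 1 x) (mkC (suc i) 1 y)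
      ordered with x <? y
      ... | yes l = by-value l
      ... | no nl = by-row-firstColumn (≤-antisym (ble⇒≤ x y h) (≮⇒≥ nl)) refl refl ≤-refl
    ranks-ascend (just x) nothing _ _ h = refl
    ranks-ascend nothing nothing _ _ h = refl

  std-cond3 : Cond3 α σ
  std-cond3 i j k i1 jl ij k1 km rewrite cell-standardize j k | cell-standardize i (suc k) | cell-standardize j (suc k) =
    relabelled (cell T j k) (cell T i (suc k)) (cell T j (suc k)) refl refl refl (c3 i j k i1 jl ij k1 km)
    where
    relabelled : ∀ A B Cc → cell T j k ≡ A → cell T i (suc k) ≡ B → cell T j (suc k) ≡ Cc → (not (A <∞ B) ∨ (Cc ≤∞ B)) ≡ true →
      (not (Maybe.map (rankAt T j k) A <∞ Maybe.map (rankAt T i (suc k)) B) ∨ (Maybe.map (rankAt T j (suc k)) Cc ≤∞ Maybe.map (rankAt T i (suc k)) B)) ≡ true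
    relabelled A nothing Cc _ _ _ _ rewrite ≤∞-nothing (Maybe.map (rankAt T j (suc k)) Cc) = ∨-zeroʳ _
    relabelled nothing (just b) Cc _ _ _ _ = refl
    relabelled (just a) (just b) Cc eA eB eC h with rankAt T j k a <? rankAt T i (suc k) b
    ... | no nl rewrite ≥⇒bltF (≮⇒≥ nl) = refl
    ... | yes l rewrite <⇒blt l = right-cell Cc eC c≤∞b
      where
      a<b : a < b
      a<b with rank-<⇒Precedes T (mkC j k a) (mkC i (suc k) b) (cell⇒∈-cellsOf T j k a eA) (cell⇒∈-cellsOf T i (suc k) b eB) l
      ... | by-value x = x
      ... | by-column _ x = ⊥-elim (<-irrefl refl (≤-trans (n≤1+n (suc k)) x))
      ... | by-row-firstColumn _ x _ _ = ⊥-elim (<-irrefl x (n<1+n k))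
      ... | by-row-otherColumn _ x _ _ = ⊥-elim (<-irrefl x (n<1+n k))
      c≤∞b : (Cc ≤∞ just b) ≡ true
      c≤∞b = implies-elim h (<⇒blt a<b)
      right-cell : ∀ Cc → cell T j (suc k) ≡ Cc → (Cc ≤∞ just b) ≡ true → (Maybe.map (rankAt T j (suc k)) Cc ≤∞ just (rankAt T i (suc k) b)) ≡ true
      right-cell (just c) eC2 hc = ≤⇒ble (<⇒≤ (rank-mono T (mkC j (suc k) c) (mkC i (suc k) b) (cell⇒∈-cellsOf T j (suc k) c eC2) ordered))
        where
        ordered : Precedes (mkC j (suc k) c) (mkC i (suc k) b)
        ordered with c <? b
        ... | yes l2 = by-value l2
        ... | no nl2 = by-row-otherColumn (≤-antisym (ble⇒≤ c b hc) (≮⇒≥ nl2)) refl (λ e → <-irrefl (sym e) (s≤s k1)) ij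

  cellsOf-standardize : cellsOf σ ≡ map (relabelCell (rankAt T)) cs
  cellsOf-standardize = cells-rel (rankAt T) 1 T

  cell-of-rank : ∀ ℓ → 1 ≤ ℓ → ℓ ≤ n → Σ[ a ∈ Cell ] (a ∈ cs) × (rank T a ≡ ℓ)
  cell-of-rank ℓ p q =
    let c1' : count (λ s → rank T s ≡ᵇ ℓ) cs ≡ 1
        c1' = trans (sym (count-map (λ x → x ≡ᵇ ℓ) (rank T) cs)) (trans (cong (count (λ x → x ≡ᵇ ℓ)) (sym (concat-standardize T))) (All.lookup std-isPermutation (∈-range1⁺ n ℓ p q))) in
    let (a , m , e) = count-pos⇒∃ (λ s → rank T s ≡ᵇ ℓ) cs (≤-reflexive (sym c1')) in a , m , beq⇒≡ _ _ e

  colOf-rank : ∀ a → a ∈ cs → colOf σ (rank T a) ≡ cl a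
  colOf-rank a ma =
    let mq : relabelCell (rankAt T) a ∈ cellsOf σ
        mq = subst (relabelCell (rankAt T) a ∈_) (sym cellsOf-standardize) (∈-map⁺ (relabelCell (rankAt T)) ma) in
    let (q2 , m2 , e2 , e3) = colOf-witness 1 σ (rank T a) (relabelCell (rankAt T) a) mq refl in
    let (a2 , ma2 , eq2) = ∈-map⁻ (relabelCell (rankAt T)) (subst (q2 ∈_) cellsOf-standardize m2) in
    trans (sym e3) (trans (cong cl eq2) (samecol a2 ma2 (trans (sym (cong vl eq2)) e2)))
    where
    samecol : ∀ a2 → a2 ∈ cs → rank T a2 ≡ rank T a → cl a2 ≡ cl a
    samecol a2 ma2 e with cl a2 ≟ cl a
    ... | yes ec = ec
    ... | no nec = ⊥-elim (rank-injective T a2 a ma2 ma (λ (_ , ec) → nec ec) e)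

  sameBlock⇒colOf-antitone : ∀ i → 1 ≤ i → i < n → block v i ≡ block v (suc i) → colOf σ (suc i) ≤ colOf σ i
  sameBlock⇒colOf-antitone i p q eqb =
    let (a , ma , ra) = cell-of-rank i p (<⇒≤ q) in
    let (b , mb , rb) = cell-of-rank (suc i) (s≤s z≤n) q in
    let vab : vl a ≡ vl b
        vab = trans (sym (block∘rank a ma)) (trans (cong (block v) ra) (trans eqb (trans (cong (block v) (sym rb)) (block∘rank b mb)))) in
    subst₂ _≤_ (trans (sym (colOf-rank b mb)) (cong (colOf σ) rb)) (trans (sym (colOf-rank a ma)) (cong (colOf σ) ra))
      (Precedes-sameValue⇒col-≥ (rank-<⇒Precedes T a b ma mb (subst₂ _<_ (sym ra) (sym rb) ≤-refl)) vab)

  std-descents-compatible : ∀ i → 1 ≤ i → i < n → colOf σ i < colOf σ (suc i) → block v i < block v (suc i)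
  std-descents-compatible i p q h with block v i <? block v (suc i)
  ... | yes r = r
  ... | no nr = ⊥-elim (<⇒≱ h (sameBlock⇒colOf-antitone i p q (block-≮⇒≡ v (n≤1+n i) nr)))

module CountBijection {A B : Set} (eqA : A → A → Bool) (eqB : B → B → Bool)
  (eqA-sound : ∀ x y → eqA x y ≡ true → x ≡ y) (eqA-refl : ∀ x → eqA x x ≡ true)
  (eqB-sound : ∀ x y → eqB x y ≡ true → x ≡ y) (eqB-refl : ∀ x → eqB x x ≡ true)
  (L₁ : List A) (L₂ : List B) (V₁ : A → Bool) (V₂ : B → Bool)
  (multiplicity₁ : ∀ x → Σ L₁ (λ y → ⟦ eqA y x ⟧) ≡ ⟦ V₁ x ⟧)
  (multiplicity₂ : ∀ x → Σ L₂ (λ y → ⟦ eqB y x ⟧) ≡ ⟦ V₂ x ⟧)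
  (all₁ : All (λ x → V₁ x ≡ true) L₁) (all₂ : All (λ x → V₂ x ≡ true) L₂)
  (P : A → Bool) (Q : B → Bool) (f : A → B) (g : B → A)
  (f-correct : ∀ x → V₁ x ≡ true → P x ≡ true → (V₂ (f x) ≡ true) × (Q (f x) ≡ true) × (g (f x) ≡ x))
  (g-correct : ∀ y → V₂ y ≡ true → Q y ≡ true → (V₁ (g y) ≡ true) × (P (g y) ≡ true) × (f (g y) ≡ y))
  where

  ⟦true⟧ : ∀ {b} → b ≡ true → ⟦ b ⟧ ≡ 1
  ⟦true⟧ refl = refl

  preimages : ∀ x → V₁ x ≡ true → Σ L₂ (λ y → ⟦ Q y ⟧ * ⟦ eqA x (g y) ⟧) ≡ ⟦ P x ⟧
  preimages x vx with P x in px
  ... | true = let (v₂ , q , gf) = f-correct x vx px in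
    trans (Σ-cong-local (All.map (λ {y} vy → only-f-x y vy v₂ q gf) all₂)) (trans (multiplicity₂ (f x)) (⟦true⟧ v₂))
    where
    only-f-x : ∀ y → V₂ y ≡ true → V₂ (f x) ≡ true → Q (f x) ≡ true → g (f x) ≡ x → ⟦ Q y ⟧ * ⟦ eqA x (g y) ⟧ ≡ ⟦ eqB y (f x) ⟧
    only-f-x y vy v₂ q gf with eqB y (f x) in e
    ... | true rewrite eqB-sound y (f x) e | q | gf | eqA-refl x = refl
    ... | false with Q y in qy
    ...   | false = refl
    ...   | true with eqA x (g y) in e₂
    ...     | false = refl
    ...     | true = ⊥-elim (true≢false (trans (sym (trans (cong (eqB y) (cong f (eqA-sound x (g y) e₂))) (trans (cong (eqB y) (proj₂ (proj₂ (g-correct y vy qy)))) (eqB-refl y)))) e))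
  ... | false = trans (Σ-cong-local (All.map (λ {y} vy → none y vy) all₂)) (Σ-0 L₂)
    where
    none : ∀ y → V₂ y ≡ true → ⟦ Q y ⟧ * ⟦ eqA x (g y) ⟧ ≡ 0
    none y vy with Q y in qy
    ... | false = refl
    ... | true with eqA x (g y) in e₂
    ...   | false = refl
    ...   | true = ⊥-elim (true≢false (trans (sym (subst (λ z → P z ≡ true) (sym (eqA-sound x (g y) e₂)) (proj₁ (proj₂ (g-correct y vy qy))))) px))

  image : ∀ y → V₂ y ≡ true → ⟦ Q y ⟧ * Σ L₁ (λ x → ⟦ eqA x (g y) ⟧) ≡ ⟦ Q y ⟧
  image y vy with Q y in qy
  ... | false = refl
  ... | true = trans (+-identityʳ _) (trans (multiplicity₁ (g y)) (⟦true⟧ (proj₁ (g-correct y vy qy))))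

  -- Both sides count the pairs (x , y) of L₁ × L₂ with Q y and x = g y.
  count-bijection : count P L₁ ≡ count Q L₂
  count-bijection =
    begin
      count P L₁
    ≡⟨ countΣ P L₁ ⟩
      Σ L₁ (λ x → ⟦ P x ⟧)
    ≡⟨ sym (Σ-cong-local (All.map (λ {x} vx → preimages x vx) all₁)) ⟩
      Σ L₁ (λ x → Σ L₂ (λ y → ⟦ Q y ⟧ * ⟦ eqA x (g y) ⟧))
    ≡⟨ Σ-swap L₁ L₂ (λ x y → ⟦ Q y ⟧ * ⟦ eqA x (g y) ⟧) ⟩
      Σ L₂ (λ y → Σ L₁ (λ x → ⟦ Q y ⟧ * ⟦ eqA x (g y) ⟧))
    ≡⟨ Σ-cong L₂ (λ y → Σ-*ˡ L₁ ⟦ Q y ⟧ (λ x → ⟦ eqA x (g y) ⟧)) ⟩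
      Σ L₂ (λ y → ⟦ Q y ⟧ * Σ L₁ (λ x → ⟦ eqA x (g y) ⟧))
    ≡⟨ Σ-cong-local (All.map (λ {y} vy → image y vy) all₂) ⟩
      Σ L₂ (λ y → ⟦ Q y ⟧)
    ≡⟨ sym (countΣ Q L₂) ⟩
      count Q L₂
    ∎
    where open ≡-Reasoning

-- The expansion

descentComp : ℕ → Filling → List ℕ
descentComp n σ = compOf n (Dhat n σ)

isSYRTᵇ : List ℕ → Filling → Bool
isSYRTᵇ α σ = isSSYRT α σ ∧ (content (sum α) σ ==ᴸ replicate (sum α) 1)

isCompatibleSYRTᵇ : List ℕ → List ℕ → Filling → Bool
isCompatibleSYRTᵇ α v σ = isSYRTᵇ α σ ∧ ((sum v ≡ᵇ sum α) ∧ refines (dropZeros v) (descentComp (sum α) σ))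

isSSYRTOfWeightᵇ : List ℕ → List ℕ → Filling → Bool
isSSYRTOfWeightᵇ α v T = isSSYRT α T ∧ (content (length v) T ==ᴸ v)

rhs≡count-compatible : ∀ α v → sum (map (λ β → dcoef α β * coeffF β v) (comps (sum α))) ≡ count (isCompatibleSYRTᵇ α v) (fillings (sum α) α)
rhs≡count-compatible α v =
  begin
    Σ (comps n) (λ β → dcoef α β * coeffF β v)
  ≡⟨ Σ-cong (comps n) (λ β → cong (_* coeffF β v) (countΣ (λ σ → descentComp n σ ==ᴸ β) (syrts α))) ⟩
    Σ (comps n) (λ β → Σ (syrts α) (λ σ → ⟦ descentComp n σ ==ᴸ β ⟧) * coeffF β v)
  ≡⟨ Σ-cong (comps n) (λ β → sym (Σ-*ʳ (syrts α) (coeffF β v) (λ σ → ⟦ descentComp n σ ==ᴸ β ⟧))) ⟩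
    Σ (comps n) (λ β → Σ (syrts α) (λ σ → ⟦ descentComp n σ ==ᴸ β ⟧ * coeffF β v))
  ≡⟨ Σ-swap (comps n) (syrts α) (λ β σ → ⟦ descentComp n σ ==ᴸ β ⟧ * coeffF β v) ⟩
    Σ (syrts α) (λ σ → Σ (comps n) (λ β → ⟦ descentComp n σ ==ᴸ β ⟧ * coeffF β v))
  ≡⟨ Σ-cong (syrts α) (λ σ → Σ-cong (comps n) (λ β → trans (sym (⟦==ᴸ⟧-subst (descentComp n σ) β (λ z → coeffF z v))) (cong (λ z → ⟦ z ⟧ * coeffF (descentComp n σ) v) (==ᴸ-sym (descentComp n σ) β)))) ⟩
    Σ (syrts α) (λ σ → Σ (comps n) (λ β → ⟦ β ==ᴸ descentComp n σ ⟧ * coeffF (descentComp n σ) v))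
  ≡⟨ Σ-cong (syrts α) (λ σ → trans (Σ-*ʳ (comps n) _ (λ β → ⟦ β ==ᴸ descentComp n σ ⟧)) (trans (cong (_* coeffF (descentComp n σ) v) (trans (comps-multiplicity n (descentComp n σ)) (cong ⟦_⟧ (proj₁ (compOf-filter-isComp _ n))))) (+-identityʳ _))) ⟩
    Σ (syrts α) (λ σ → coeffF (descentComp n σ) v)
  ≡⟨ Σ-cong (syrts α) (λ σ → trans (coeffF-indicator (descentComp n σ) v) (cong (λ z → ⟦ sum v ≡ᵇ z ⟧ * ⟦ refines (dropZeros v) (descentComp n σ) ⟧) (proj₂ (compOf-filter-isComp _ n)))) ⟩
    Σ (syrts α) (λ σ → ⟦ sum v ≡ᵇ n ⟧ * ⟦ refines (dropZeros v) (descentComp n σ) ⟧)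
  ≡⟨ filterΣ _ (fillings n α) _ ⟩
    Σ (fillings n α) (λ σ → ⟦ isSYRTᵇ α σ ⟧ * (⟦ sum v ≡ᵇ n ⟧ * ⟦ refines (dropZeros v) (descentComp n σ) ⟧))
  ≡⟨ Σ-cong (fillings n α) (λ σ → sym (trans (⟦∧⟧ (isSYRTᵇ α σ) _) (cong (⟦ isSYRTᵇ α σ ⟧ *_) (⟦∧⟧ (sum v ≡ᵇ n) _)))) ⟩
    Σ (fillings n α) (λ σ → ⟦ isCompatibleSYRTᵇ α v σ ⟧)
  ≡⟨ sym (countΣ _ (fillings n α)) ⟩
    count (isCompatibleSYRTᵇ α v) (fillings n α)
  ∎
  where
  open ≡-Reasoning
  n : ℕ
  n = sum α

standardize-correct : ∀ α v T → isFillingᵇ (length v) α T ≡ true → isSSYRTOfWeightᵇ α v T ≡ true →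
  (isFillingᵇ (sum α) α (standardize T) ≡ true) × (isCompatibleSYRTᵇ α v (standardize T) ≡ true) × (destandardize v (standardize T) ≡ T)
standardize-correct α v T vT pT = std-isFilling , isCompatible , destandardize∘standardize
  where
  n : ℕ
  n = sum α
  conds : Cond1 T × Cond2 α T × Cond3 α T
  conds = isSSYRT-sound α T (proj₁ (∧-elim {isSSYRT α T} pT))
  open Standardize α v T vT (proj₁ conds) (proj₁ (proj₂ conds)) (proj₂ (proj₂ conds)) (content-sound T v (proj₂ (∧-elim {isSSYRT α T} pT))) hiding (n; N)
  isCompatible : isCompatibleSYRTᵇ α v σ ≡ true
  isCompatible =
    ∧-intro (∧-intro (isSSYRT-complete α σ std-cond1 std-cond2 std-cond3)
                     (subst (λ z → (content n σ ==ᴸ z) ≡ true) (trans (map-cong-local std-isPermutation) (map-const1 n)) (==ᴸ-refl (content n σ))))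
            (∧-intro (subst (λ z → (z ≡ᵇ n) ≡ true) (sym sum-weight) (beq-refl n))
                     (partialSums⇒refines-compOf (dropZeros v) n (λ i → colOf σ i <ᵇ colOf σ (suc i)) (dropZeros-positive v) (trans (sum-dropZeros v) sum-weight)
                        (λ i p q di → trans (sym (block-step≡isPartialSum v i p)) (<⇒blt (std-descents-compatible i p q (blt⇒< _ _ di))))))

destandardize-correct : ∀ α v σ → isFillingᵇ (sum α) α σ ≡ true → isCompatibleSYRTᵇ α v σ ≡ true →
  (isFillingᵇ (length v) α (destandardize v σ) ≡ true) × (isSSYRTOfWeightᵇ α v (destandardize v σ) ≡ true) × (standardize (destandardize v σ) ≡ σ)
destandardize-correct α v σ vσ qσ =
  destd-isFilling , ∧-intro (isSSYRT-complete α _ destd-cond1 destd-cond2 destd-cond3) destd-content ,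
  standardize∘destandardize
  where
  n : ℕ
  n = sum α
  syrt : (isSSYRT α σ ≡ true) × ((content n σ ==ᴸ replicate n 1) ≡ true)
  syrt = ∧-elim {isSSYRT α σ} (proj₁ (∧-elim {isSYRTᵇ α σ} qσ))
  compatible : ((sum v ≡ᵇ n) ≡ true) × (refines (dropZeros v) (descentComp n σ) ≡ true)
  compatible = ∧-elim {sum v ≡ᵇ n} (proj₂ (∧-elim {isSYRTᵇ α σ} qσ))
  conds : Cond1 σ × Cond2 α σ × Cond3 α σ
  conds = isSSYRT-sound α σ (proj₁ syrt)
  perm : All (λ t → count (λ x → x ≡ᵇ t) (concat σ) ≡ 1) (range1 n)
  perm = map-≡⇒pointwise _ (λ _ → 1) (range1 n) (trans (==ᴸ-sound _ _ (proj₂ syrt)) (sym (map-const1 n)))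
  descents-compatible : ∀ i → 1 ≤ i → i < n → colOf σ i < colOf σ (suc i) → block v i < block v (suc i)
  descents-compatible i p q h = blt⇒< _ _ (trans (block-step≡isPartialSum v i p) (refines-compOf⇒partialSums (dropZeros v) n (λ i → colOf σ i <ᵇ colOf σ (suc i)) (dropZeros-positive v) (trans (sum-dropZeros v) (beq⇒≡ _ _ (proj₁ compatible))) (proj₂ compatible) i p q (<⇒blt h)))
  open Destandardize α v σ (beq⇒≡ _ _ (proj₁ compatible)) vσ (proj₁ conds) (proj₁ (proj₂ conds)) (proj₂ (proj₂ conds)) perm descents-compatible hiding (n)

coeffR≡count-compatible : ∀ α v → coeffR α v ≡ count (isCompatibleSYRTᵇ α v) (fillings (sum α) α)
coeffR≡count-compatible α v = count-bijection
  where
  open CountBijection eqFilling eqFilling eqFilling-sound eqFilling-refl eqFilling-sound eqFilling-refl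
    (fillings (length v) α) (fillings (sum α) α) (isFillingᵇ (length v) α) (isFillingᵇ (sum α) α)
    (fillings-multiplicity (length v) α) (fillings-multiplicity (sum α) α) (All-fillings-isFilling (length v) α) (All-fillings-isFilling (sum α) α)
    (isSSYRTOfWeightᵇ α v) (isCompatibleSYRTᵇ α v) standardize (destandardize v) (standardize-correct α v) (destandardize-correct α v)

proposition1 : (α : List ℕ) → All (λ a → 0 < a) α → (v : List ℕ) →
    coeffR α v ≡ sum (map (λ β → dcoef α β * coeffF β v) (comps (sum α)))
proposition1 α _ v = trans (coeffR≡count-compatible α v) (sym (rhs≡count-compatible α v))
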